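{- Let $\ell_1,\ell_2$ be integers with $1<\ell_2<\ell_1-1$, let $\mathscr{M}=\{(a,b)\in\mathbb{Z}^2: 0\le a\le\ell_1-1,\ 0\le b\le\ell_2-1\}$ with the componentwise order, and let $\mathrm{wt}$ be a rank increasing and rank constant weight function on $\mathscr{M}$. Let $A\subseteq\mathscr{M}$ be a downset. (1) If $A$ is the initial segment of size $|A|$ of $\mathcal{L}$, then $A$ is optimal if and only if $|A|\le\ell_2$ or $|A|\ge\ell_2(\ell_1-1)$. (2) If $A$ is the initial segment of size $|A|$ of $\mathcal{C}$, then $A$ is optimal.
   Context: The rank of $(a,b)$ is $a+b$; $\mathrm{wt}$ is rank constant if equal ranks give equal weights and rank increasing if strictly smaller rank gives strictly smaller weight; $\mathrm{wt}(S)=\sum_{s\in S}\mathrm{wt}(s)$. A downset is a subset closed downward in the componentwise order; it is optimal if its weight is at least that of every downset of the same size. $\mathcal{L}$: $(a,b)<(c,d)$ iff $a<c$, or $a=c$ and $b<d$. $\mathcal{C}$: $(a,b)<(c,d)$ iff $b<d$, or $b=d$ and $a<c$. The initial segment of size $m$ is the set of the $m$ smallest elements.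
   Formalization: The weight function wt takes values in ℚ rather than in ℝ. -}

module Defs where

open import Data.Nat using (ℕ; zero; suc; _+_; _<_; _<ᵇ_; _≡ᵇ_)
open import Data.Fin using (Fin; toℕ)
import Data.Fin as F
open import Data.Bool using (Bool; true; false; if_then_else_; _∧_; _∨_)
open import Data.Product using (_×_; _,_)
open import Data.Rational using (ℚ; 0ℚ) renaming (_+_ to _+ℚ_; _≤_ to _≤ℚ_; _<_ to _<ℚ_)
open import Relation.Binary.PropositionalEquality using (_≡_)

Pt : ℕ → ℕ → Set
Pt ℓ₁ ℓ₂ = Fin ℓ₁ × Fin ℓ₂

Subset : ℕ → ℕ → Set
Subset ℓ₁ ℓ₂ = Pt ℓ₁ ℓ₂ → Bool

sumFinℕ : ∀ {n} → (Fin n → ℕ) → ℕ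
sumFinℕ {zero}  f = 0
sumFinℕ {suc n} f = f F.zero + sumFinℕ (λ i → f (F.suc i))

sumFinℚ : ∀ {n} → (Fin n → ℚ) → ℚ
sumFinℚ {zero}  f = 0ℚ
sumFinℚ {suc n} f = f F.zero +ℚ sumFinℚ (λ i → f (F.suc i))

card : ∀ {ℓ₁ ℓ₂} → Subset ℓ₁ ℓ₂ → ℕ
card S = sumFinℕ (λ a → sumFinℕ (λ b → if S (a , b) then 1 else 0))

rank : ∀ {ℓ₁ ℓ₂} → Pt ℓ₁ ℓ₂ → ℕ
rank (a , b) = toℕ a + toℕ b

Weight : ℕ → ℕ → Set
Weight ℓ₁ ℓ₂ = Pt ℓ₁ ℓ₂ → ℚ

wtSet : ∀ {ℓ₁ ℓ₂} → Weight ℓ₁ ℓ₂ → Subset ℓ₁ ℓ₂ → ℚ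
wtSet wt S = sumFinℚ (λ a → sumFinℚ (λ b → if S (a , b) then wt (a , b) else 0ℚ))

RankConstant : ∀ {ℓ₁ ℓ₂} → Weight ℓ₁ ℓ₂ → Set
RankConstant wt = ∀ x y → rank x ≡ rank y → wt x ≡ wt y

RankIncreasing : ∀ {ℓ₁ ℓ₂} → Weight ℓ₁ ℓ₂ → Set
RankIncreasing wt = ∀ x y → rank x < rank y → wt x <ℚ wt y

_≤P_ : ∀ {ℓ₁ ℓ₂} → Pt ℓ₁ ℓ₂ → Pt ℓ₁ ℓ₂ → Set
(a , b) ≤P (c , d) = (toℕ a Data.Nat.≤ toℕ c) × (toℕ b Data.Nat.≤ toℕ d)

Downset : ∀ {ℓ₁ ℓ₂} → Subset ℓ₁ ℓ₂ → Set
Downset S = ∀ x y → x ≤P y → S y ≡ true → S x ≡ true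

Optimal : ∀ {ℓ₁ ℓ₂} → Weight ℓ₁ ℓ₂ → Subset ℓ₁ ℓ₂ → Set
Optimal wt A = ∀ B → Downset B → card B ≡ card A → wtSet wt B ≤ℚ wtSet wt A

_<L_ : ∀ {ℓ₁ ℓ₂} → Pt ℓ₁ ℓ₂ → Pt ℓ₁ ℓ₂ → Bool
(a , b) <L (c , d) = (toℕ a <ᵇ toℕ c) ∨ ((toℕ a ≡ᵇ toℕ c) ∧ (toℕ b <ᵇ toℕ d))

_<C_ : ∀ {ℓ₁ ℓ₂} → Pt ℓ₁ ℓ₂ → Pt ℓ₁ ℓ₂ → Bool
(a , b) <C (c , d) = (toℕ b <ᵇ toℕ d) ∨ ((toℕ b ≡ᵇ toℕ d) ∧ (toℕ a <ᵇ toℕ c))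

below : ∀ {ℓ₁ ℓ₂} → (Pt ℓ₁ ℓ₂ → Pt ℓ₁ ℓ₂ → Bool) → Pt ℓ₁ ℓ₂ → Subset ℓ₁ ℓ₂
below _≺_ x y = y ≺ x

-- S is the initial segment of size m of the total order ≺, i.e. the set of the
-- m smallest elements: x ∈ S iff fewer than m elements lie strictly below x.
InitialSegment : ∀ {ℓ₁ ℓ₂} → (Pt ℓ₁ ℓ₂ → Pt ℓ₁ ℓ₂ → Bool) → ℕ → Subset ℓ₁ ℓ₂ → Set
InitialSegment _≺_ m S = ∀ x → (S x ≡ true → card (below _≺_ x) < m)
                             × (card (below _≺_ x) < m → S x ≡ true)

-- The weight of a set S is determined by its rank tails N_S(t) = #{x ∈ S : rank x ≥ t}: if w_r is the
-- weight of the points of rank r, then wt(S) = |S|·w₀ + Σ_{t ≥ 1} N_S(t)·(w_t − w_{t−1}) with positive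
-- increments.  Hence a downset is optimal as soon as its rank tails dominate those of every downset of the
-- same size, and it is not optimal if another downset of its size beats it at a single t.
--
-- For ℓ₂ ≤ ℓ₁ the 𝒞-initial segment, i.e. the row-major filling of the box, has pointwise maximal rank
-- tails among all downsets of its size.  By induction on the box: a downset splits into its first column,
-- a prefix of some height q, and a downset of the narrower box that lives in the lowest q rows; a column of
-- height q followed by a row-major filling of width w is dominated by the row-major filling of width w + 1.
-- In a square box, either the first row is full and is split off, or the downset fits in a narrower box
-- and can be transposed.
--
-- The 𝓛-initial segment is the column-major filling.  Its rank tails equal those of the row-major filling
-- when it fits in one column, or when it misses at most ℓ₂ cells of the box: the full box has symmetric
-- rank tails, and in both fillings the missing cells are the last ones of the last line, of equal ranks.
-- Otherwise the column-major filling contains every cell of rank below some T and has all ranks below some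
-- t₁, while the row-major filling either misses a cell of rank below T or has a cell of rank t₁.

{-# OPTIONS --safe #-}
module Submission where

open import Defs
open import Algebra.Bundles using (CommutativeMonoid)
open import Data.Bool using (Bool; true; false; _∧_; _∨_; if_then_else_)
open import Data.Bool.Properties using (T-≡; ¬-not; ∧-zeroʳ; ∧-identityʳ)
open import Data.Fin as Fin using (Fin; toℕ; fromℕ<)
open import Data.Fin.Properties using (toℕ<n; fromℕ<-toℕ; toℕ-fromℕ<)
open import Data.Nat
open import Data.Nat.DivMod using (_/_; _%_; m≡m%n+[m/n]*n; m%n<n)
open import Data.Nat.Properties
open import Data.Nat.Tactic.RingSolver using (solve-∀)
open import Data.Product using (_×_; _,_; proj₁; proj₂; ∃-syntax; map₂)
open import Data.Rational as ℚ using (ℚ; 0ℚ)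
import Data.Rational.Properties as ℚ
open import Data.Sum using (_⊎_; inj₁; inj₂)
open import Function using (_∘_; _⇔_; mk⇔; Equivalence)
open import Relation.Binary.PropositionalEquality hiding ([_]; J)
open import Relation.Nullary using (¬_; yes; no; contradiction)

open import Algebra.Properties.CommutativeSemigroup +-commutativeSemigroup using (interchange)
open import Algebra.Properties.Group ℚ.+-0-group using (\\-leftDividesˡ)
open import Algebra.Properties.Monoid.Mult ℚ.+-0-monoid using (×-homo-+) renaming (_×_ to _·_)
open import Algebra.Properties.CommutativeSemigroup (CommutativeMonoid.commutativeSemigroup ℚ.+-0-commutativeMonoid)
  using () renaming (interchange to ℚ-interchange)

open Equivalence using (to; from)

[_] : Bool → ℕ
[ b ] = if b then 1 else 0

[]≤1 : ∀ b → [ b ] ≤ 1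
[]≤1 true  = ≤-refl
[]≤1 false = z≤n

[false∧] : ∀ {x} y → x ≡ false → [ x ∧ y ] ≡ 0
[false∧] y refl = refl

[∧]-mono : ∀ x y z → (z ≡ true → y ≡ true) → [ x ∧ z ] ≤ [ y ∧ z ]
[∧]-mono x y false _   rewrite ∧-zeroʳ x = z≤n
[∧]-mono x y true  z⇒y rewrite z⇒y refl = []≤1 (x ∧ true)

∧-true⁻ : ∀ {x y} → x ∧ y ≡ true → x ≡ true × y ≡ true
∧-true⁻ {true} {true} _ = refl , refl

≤ᵇ-true : ∀ {m n} → m ≤ n → (m ≤ᵇ n) ≡ true
≤ᵇ-true m≤n = to T-≡ (≤⇒≤ᵇ m≤n)

≤ᵇ-sound : ∀ m n → (m ≤ᵇ n) ≡ true → m ≤ n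
≤ᵇ-sound m n eq = ≤ᵇ⇒≤ m n (from T-≡ eq)

≤ᵇ-false : ∀ {m n} → n < m → (m ≤ᵇ n) ≡ false
≤ᵇ-false {m} {n} n<m with m ≤ᵇ n in eq
... | false = refl
... | true  = contradiction (≤ᵇ-sound m n eq) (<⇒≱ n<m)

<ᵇ-true : ∀ {m n} → m < n → (m <ᵇ n) ≡ true
<ᵇ-true = ≤ᵇ-true

<ᵇ-sound : ∀ m n → (m <ᵇ n) ≡ true → m < n
<ᵇ-sound m n = ≤ᵇ-sound (suc m) n

≡-<ᵇ : ∀ x n m → (x ≡ true → n < m) → (n < m → x ≡ true) → x ≡ (n <ᵇ m)
≡-<ᵇ x n m x⇒n<m n<m⇒x with n <? m
... | yes n<m = trans (n<m⇒x n<m) (sym (<ᵇ-true n<m))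
... | no  n≮m = trans (¬-not (n≮m ∘ x⇒n<m)) (sym (≤ᵇ-false (s≤s (≮⇒≥ n≮m))))

≤ᵇ-suc : ∀ t x → (t ≤ᵇ suc x) ≡ (t ∸ 1 ≤ᵇ x)
≤ᵇ-suc zero          x = refl
≤ᵇ-suc (suc zero)    x = refl
≤ᵇ-suc (suc (suc t)) x = refl

<ᵇ-+ : ∀ w x m → (w + x <ᵇ m) ≡ (x <ᵇ m ∸ w)
<ᵇ-+ zero    x m       = refl
<ᵇ-+ (suc w) x zero    = refl
<ᵇ-+ (suc w) x (suc m) = <ᵇ-+ w x m

[≤ᵇ]+[<ᵇ] : ∀ t r → [ t ≤ᵇ r ] + [ r <ᵇ t ] ≡ 1
[≤ᵇ]+[<ᵇ] zero          r       = refl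
[≤ᵇ]+[<ᵇ] (suc t)       zero    = refl
[≤ᵇ]+[<ᵇ] (suc zero)    (suc r) = refl
[≤ᵇ]+[<ᵇ] (suc (suc t)) (suc r) = [≤ᵇ]+[<ᵇ] (suc t) r

[≤ᵇ]-mono : ∀ t {x y} → x ≤ y → [ t ≤ᵇ x ] ≤ [ t ≤ᵇ y ]
[≤ᵇ]-mono t {x} {y} x≤y with t ≤ᵇ x in eq
... | false = z≤n
... | true  = subst (λ b → 1 ≤ [ b ]) (sym (≤ᵇ-true (≤-trans (≤ᵇ-sound t x eq) x≤y))) ≤-refl

∑ : ℕ → (ℕ → ℕ) → ℕ
∑ zero    f = 0
∑ (suc n) f = f 0 + ∑ n (f ∘ suc)

∑-cong : ∀ n {f g : ℕ → ℕ} → (∀ i → i < n → f i ≡ g i) → ∑ n f ≡ ∑ n g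
∑-cong zero    _   = refl
∑-cong (suc n) f≗g = cong₂ _+_ (f≗g 0 z<s) (∑-cong n (λ i i<n → f≗g (suc i) (s<s i<n)))

∑-zero : ∀ n {f : ℕ → ℕ} → (∀ i → i < n → f i ≡ 0) → ∑ n f ≡ 0
∑-zero zero    _ = refl
∑-zero (suc n) h rewrite h 0 z<s = ∑-zero n (λ i i<n → h (suc i) (s<s i<n))

∑-const : ∀ n c → ∑ n (λ _ → c) ≡ n * c
∑-const zero    c = refl
∑-const (suc n) c = cong (c +_) (∑-const n c)

∑-+ : ∀ n (f g : ℕ → ℕ) → ∑ n (λ i → f i + g i) ≡ ∑ n f + ∑ n g
∑-+ zero    f g = refl
∑-+ (suc n) f g =
  trans (cong (f 0 + g 0 +_) (∑-+ n (f ∘ suc) (g ∘ suc))) (interchange (f 0) (g 0) _ _)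

∑-comm : ∀ m n (f : ℕ → ℕ → ℕ) → ∑ m (λ i → ∑ n (f i)) ≡ ∑ n (λ j → ∑ m (λ i → f i j))
∑-comm zero    n f = sym (∑-zero n (λ _ _ → refl))
∑-comm (suc m) n f = begin
  ∑ n (f 0) + ∑ m (λ i → ∑ n (f (suc i)))         ≡⟨ cong (∑ n (f 0) +_) (∑-comm m n (f ∘ suc)) ⟩
  ∑ n (f 0) + ∑ n (λ j → ∑ m (λ i → f (suc i) j)) ≡⟨ ∑-+ n (f 0) _ ⟨
  ∑ n (λ j → f 0 j + ∑ m (λ i → f (suc i) j))     ∎
  where open ≡-Reasoning

∑-split : ∀ m n (f : ℕ → ℕ) → ∑ (m + n) f ≡ ∑ m f + ∑ n (λ i → f (m + i))
∑-split zero    n f = refl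
∑-split (suc m) n f rewrite ∑-split m n (f ∘ suc) = sym (+-assoc (f 0) _ _)

∑-vanishing-tail : ∀ q n (f : ℕ → ℕ) → q ≤ n → (∀ i → q ≤ i → f i ≡ 0) → ∑ n f ≡ ∑ q f
∑-vanishing-tail q n f q≤n vanish = begin
  ∑ n f                               ≡⟨ cong (λ k → ∑ k f) (m+[n∸m]≡n q≤n) ⟨
  ∑ (q + (n ∸ q)) f                   ≡⟨ ∑-split q (n ∸ q) f ⟩
  ∑ q f + ∑ (n ∸ q) (λ i → f (q + i))
    ≡⟨ cong (∑ q f +_) (∑-zero (n ∸ q) (λ i _ → vanish (q + i) (m≤m+n q i))) ⟩
  ∑ q f + 0                           ≡⟨ +-identityʳ _ ⟩
  ∑ q f                               ∎
  where open ≡-Reasoning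

∑-mono-≤ : ∀ n {f g : ℕ → ℕ} → (∀ i → i < n → f i ≤ g i) → ∑ n f ≤ ∑ n g
∑-mono-≤ zero    _   = z≤n
∑-mono-≤ (suc n) f≤g = +-mono-≤ (f≤g 0 z<s) (∑-mono-≤ n (λ i i<n → f≤g (suc i) (s<s i<n)))

∑-mono-< : ∀ n {f g : ℕ → ℕ} → (∀ i → i < n → f i ≤ g i) → ∀ k → k < n → f k < g k → ∑ n f < ∑ n g
∑-mono-< (suc n) f≤g zero    _         fk<gk =
  +-mono-<-≤ fk<gk (∑-mono-≤ n (λ i i<n → f≤g (suc i) (s<s i<n)))
∑-mono-< (suc n) f≤g (suc k) (s<s k<n) fk<gk =
  +-mono-≤-< (f≤g 0 z<s) (∑-mono-< n (λ i i<n → f≤g (suc i) (s<s i<n)) k k<n fk<gk)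

term≤∑ : ∀ n (f : ℕ → ℕ) k → k < n → f k ≤ ∑ n f
term≤∑ (suc n) f zero    _         = m≤m+n (f 0) _
term≤∑ (suc n) f (suc k) (s<s k<n) = ≤-trans (term≤∑ n (f ∘ suc) k k<n) (m≤n+m _ (f 0))

∑-≤-* : ∀ n c {f : ℕ → ℕ} → (∀ i → i < n → f i ≤ c) → ∑ n f ≤ n * c
∑-≤-* n c {f} f≤c = subst (∑ n f ≤_) (∑-const n c) (∑-mono-≤ n f≤c)

∑[]≤ : ∀ n (p : ℕ → Bool) → ∑ n (λ i → [ p i ]) ≤ n
∑[]≤ n p = subst (∑ n (λ i → [ p i ]) ≤_) (*-identityʳ n)
  (∑-≤-* n 1 {λ i → [ p i ]} (λ i _ → []≤1 (p i)))

∑-<ᵇ : ∀ w m → ∑ w (λ a → [ a <ᵇ m ]) ≡ w ⊓ m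
∑-<ᵇ zero    m       = refl
∑-<ᵇ (suc w) zero    = ∑-zero w (λ _ _ → refl)
∑-<ᵇ (suc w) (suc m) = cong suc (∑-<ᵇ w m)

∑-<ᵇ-≤ : ∀ n A → A ≤ n → ∑ n (λ a → [ a <ᵇ A ]) ≡ A
∑-<ᵇ-≤ n A A≤n = trans (∑-<ᵇ n A) (m≥n⇒m⊓n≡n A≤n)

-- Row-major fillings

span≥ : ℕ → ℕ → ℕ → ℕ
span≥ lo len t = ∑ len (λ i → [ t ≤ᵇ lo + i ])

span≥-split : ∀ lo m n t → span≥ lo (m + n) t ≡ span≥ lo m t + span≥ (lo + m) n t
span≥-split lo m n t = trans (∑-split m n _)
  (cong (span≥ lo m t +_) (∑-cong n (λ i _ → cong (λ x → [ t ≤ᵇ x ]) (sym (+-assoc lo m i)))))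

span≥-suc : ∀ lo len t → span≥ (suc lo) len t ≡ span≥ lo len (t ∸ 1)
span≥-suc lo len t = ∑-cong len (λ i _ → cong [_] (≤ᵇ-suc t (lo + i)))

span≥-mono : ∀ {lo lo′} len t → lo ≤ lo′ → span≥ lo len t ≤ span≥ lo′ len t
span≥-mono len t lo≤lo′ = ∑-mono-≤ len (λ i _ → [≤ᵇ]-mono t (+-monoˡ-≤ i lo≤lo′))

span≥-zero : ∀ lo len → span≥ lo len 0 ≡ len
span≥-zero lo len = trans (∑-const len 1) (*-identityʳ len)

rowMajorTail : (w h m t : ℕ) → ℕ
rowMajorTail w zero    m t = 0
rowMajorTail w (suc h) m t = span≥ 0 (w ⊓ m) t + rowMajorTail w h (m ∸ w) (t ∸ 1)

m≤n*[1+o]⇒m∸n≤n*o : ∀ {m} n o → m ≤ n * suc o → m ∸ n ≤ n * o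
m≤n*[1+o]⇒m∸n≤n*o {m} n o m≤ = begin
  m ∸ n           ≤⟨ ∸-monoˡ-≤ n m≤ ⟩
  n * suc o ∸ n   ≡⟨ cong (_∸ n) (*-suc n o) ⟩
  n + n * o ∸ n   ≡⟨ m+n∸m≡n n (n * o) ⟩
  n * o           ∎
  where open ≤-Reasoning

rowMajorTail-empty : ∀ w h t → rowMajorTail w h 0 t ≡ 0
rowMajorTail-empty w zero    t = refl
rowMajorTail-empty w (suc h) t rewrite ⊓-zeroʳ w | 0∸n≡0 w = rowMajorTail-empty w h (t ∸ 1)

rowMajorTail-suc-height : ∀ w h m t → m ≤ w * h → rowMajorTail w (suc h) m t ≡ rowMajorTail w h m t
rowMajorTail-suc-height w zero m t m≤0
  rewrite n≤0⇒n≡0 (≤-trans m≤0 (≤-reflexive (*-zeroʳ w))) | ⊓-zeroʳ w = refl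
rowMajorTail-suc-height w (suc h) m t m≤ =
  cong (span≥ 0 (w ⊓ m) t +_) (rowMajorTail-suc-height w h (m ∸ w) (t ∸ 1) (m≤n*[1+o]⇒m∸n≤n*o w h m≤))

rowMajorTail-one-row : ∀ w h m t → m ≤ w → rowMajorTail w (suc h) m t ≡ span≥ 0 m t
rowMajorTail-one-row w h m t m≤w
  rewrite m≥n⇒m⊓n≡n m≤w | m≤n⇒m∸n≡0 m≤w | rowMajorTail-empty w h (t ∸ 1) = +-identityʳ _

rowMajorTail-full-row : ∀ w h m t → w ≤ m →
  rowMajorTail w (suc h) m t ≡ span≥ 0 w t + rowMajorTail w h (m ∸ w) (t ∸ 1)
rowMajorTail-full-row w h m t w≤m =
  cong (λ x → span≥ 0 x t + rowMajorTail w h (m ∸ w) (t ∸ 1)) (m≤n⇒m⊓n≡m w≤m)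

rowMajorTail-size : ∀ w h m → m ≤ w * h → rowMajorTail w h m 0 ≡ m
rowMajorTail-size w zero    m m≤0 = sym (n≤0⇒n≡0 (≤-trans m≤0 (≤-reflexive (*-zeroʳ w))))
rowMajorTail-size w (suc h) m m≤ = begin
  span≥ 0 (w ⊓ m) 0 + rowMajorTail w h (m ∸ w) 0
    ≡⟨ cong₂ _+_ (span≥-zero 0 (w ⊓ m)) (rowMajorTail-size w h (m ∸ w) (m≤n*[1+o]⇒m∸n≤n*o w h m≤)) ⟩
  w ⊓ m + (m ∸ w)
    ≡⟨ m⊓n+n∸m≡n w m ⟩
  m ∎
  where open ≡-Reasoning

column+row≤one-row : ∀ q n t → 1 ≤ q → span≥ 0 q t + span≥ 0 n (t ∸ 1) ≤ span≥ 0 (q + n) t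
column+row≤one-row q n t 1≤q = begin
  span≥ 0 q t + span≥ 0 n (t ∸ 1) ≡⟨ cong (span≥ 0 q t +_) (span≥-suc 0 n t) ⟨
  span≥ 0 q t + span≥ 1 n t       ≤⟨ +-monoʳ-≤ (span≥ 0 q t) (span≥-mono n t 1≤q) ⟩
  span≥ 0 q t + span≥ q n t       ≡⟨ span≥-split 0 q n t ⟨
  span≥ 0 (q + n) t               ∎
  where open ≤-Reasoning

-- With e = q + n − (w + 1) and d = w − n, the left side counts the ranks {0} ∪ [1, 1 + e) ∪ [1 + e, 1 + e + d)
-- and [1, 1 + n), the right side {0} ∪ [1, 1 + n) ∪ [1 + n, 1 + n + d) and [1, 1 + e): they differ only in a
-- block of d ranks, which starts later on the right because e ≤ n.
column+row≤two-rows : ∀ w q n t → n < w → q ≤ suc w → suc w ≤ q + n →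
  span≥ 0 q t + span≥ 0 n (t ∸ 1) ≤ span≥ 0 (suc w) t + span≥ 0 (q + n ∸ suc w) (t ∸ 1)
column+row≤two-rows w q n t n<w q≤1+w 1+w≤q+n = begin
  span≥ 0 q t + span≥ 0 n (t ∸ 1)
    ≡⟨ cong₂ _+_ (cong (λ x → span≥ 0 x t) q≡) (sym (span≥-suc 0 n t)) ⟩
  span≥ 0 (1 + (e + d)) t + span≥ 1 n t
    ≡⟨ cong (_+ span≥ 1 n t) (split-at e) ⟩
  z + (span≥ 1 e t + span≥ (1 + e) d t) + span≥ 1 n t
    ≡⟨ swap z (span≥ 1 e t) (span≥ (1 + e) d t) (span≥ 1 n t) ⟩
  z + (span≥ 1 n t + span≥ (1 + e) d t) + span≥ 1 e t
    ≤⟨ +-monoˡ-≤ (span≥ 1 e t) (+-monoʳ-≤ z (+-monoʳ-≤ (span≥ 1 n t) (span≥-mono d t (s≤s e≤n)))) ⟩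
  z + (span≥ 1 n t + span≥ (1 + n) d t) + span≥ 1 e t
    ≡⟨ cong (_+ span≥ 1 e t) (split-at n) ⟨
  span≥ 0 (1 + (n + d)) t + span≥ 1 e t
    ≡⟨ cong₂ _+_ (cong (λ x → span≥ 0 x t) (sym 1+w≡)) (span≥-suc 0 e t) ⟩
  span≥ 0 (suc w) t + span≥ 0 e (t ∸ 1) ∎
  where
  open ≤-Reasoning
  e = q + n ∸ suc w
  d = w ∸ n
  z = span≥ 0 1 t
  d+n≡w : d + n ≡ w
  d+n≡w = m∸n+n≡m (<⇒≤ n<w)
  1+w≡ : suc w ≡ suc (n + d)
  1+w≡ = cong suc (trans (sym d+n≡w) (+-comm d n))
  q≡ : q ≡ suc (e + d)
  q≡ = +-cancelʳ-≡ n q (suc (e + d)) (begin-equality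
    q + n           ≡⟨ m∸n+n≡m 1+w≤q+n ⟨
    e + suc w       ≡⟨ cong (λ x → e + suc x) d+n≡w ⟨
    e + suc (d + n) ≡⟨ reassoc e d n ⟩
    suc (e + d) + n ∎)
    where
    reassoc : ∀ e d n → e + suc (d + n) ≡ suc (e + d) + n
    reassoc = solve-∀
  e≤n : e ≤ n
  e≤n = +-cancelʳ-≤ (suc w) e n (begin
    e + suc w ≡⟨ m∸n+n≡m 1+w≤q+n ⟩
    q + n     ≤⟨ +-monoˡ-≤ n q≤1+w ⟩
    suc w + n ≡⟨ +-comm (suc w) n ⟩
    n + suc w ∎)
  split-at : ∀ k → span≥ 0 (1 + (k + d)) t ≡ z + (span≥ 1 k t + span≥ (1 + k) d t)
  split-at k = trans (span≥-split 0 1 (k + d) t) (cong (z +_) (span≥-split 1 k d t))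
  swap : ∀ a b c x → a + (b + c) + x ≡ a + (x + c) + b
  swap = solve-∀

column+row≤rowMajorTail : ∀ w h q n t → 1 ≤ q → q ≤ suc h → q ≤ suc w → n < w →
  span≥ 0 q t + span≥ 0 n (t ∸ 1) ≤ rowMajorTail (suc w) (suc h) (q + n) t
column+row≤rowMajorTail w h q n t 1≤q q≤1+h q≤1+w n<w with q + n ≤? suc w
... | yes q+n≤1+w = ≤-trans (column+row≤one-row q n t 1≤q)
                            (≤-reflexive (sym (rowMajorTail-one-row (suc w) h (q + n) t q+n≤1+w)))
... | no  q+n≰1+w = ≤-trans (column+row≤two-rows w q n t n<w q≤1+w 1+w≤q+n) (≤-reflexive (sym (begin
  rowMajorTail (suc w) (suc h) (q + n) t
    ≡⟨ rowMajorTail-full-row (suc w) h (q + n) t 1+w≤q+n ⟩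
  span≥ 0 (suc w) t + rowMajorTail (suc w) h r (t ∸ 1)
    ≡⟨ cong (span≥ 0 (suc w) t +_) (remainder h q≤1+h) ⟩
  span≥ 0 (suc w) t + span≥ 0 r (t ∸ 1) ∎)))
  where
  open ≡-Reasoning
  r = q + n ∸ suc w
  1+w≤q+n : suc w ≤ q + n
  1+w≤q+n = <⇒≤ (≰⇒> q+n≰1+w)
  r≤1+w : r ≤ suc w
  r≤1+w = ≤-trans (∸-monoˡ-≤ (suc w) (+-monoˡ-≤ n q≤1+w))
                  (≤-trans (≤-reflexive (m+n∸m≡n (suc w) n)) (<⇒≤ (m<n⇒m<1+n n<w)))
  remainder : ∀ h → q ≤ suc h → rowMajorTail (suc w) h r (t ∸ 1) ≡ span≥ 0 r (t ∸ 1)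
  remainder zero    q≤1 =
    contradiction 1+w≤q+n (<⇒≱ (<-≤-trans (+-monoʳ-< q (n<1+n n)) (+-mono-≤ q≤1 n<w)))
  remainder (suc h) _   = rowMajorTail-one-row (suc w) h r (t ∸ 1) r≤1+w

column+rowMajorTail≤rowMajorTail : ∀ w h q n t → q ≤ h → q ≤ suc w → n ≤ w * q →
  span≥ 0 q t + rowMajorTail w h n (t ∸ 1) ≤ rowMajorTail (suc w) h (q + n) t
column+rowMajorTail≤rowMajorTail w h zero n t _ _ n≤0
  rewrite n≤0⇒n≡0 (≤-trans n≤0 (≤-reflexive (*-zeroʳ w))) | rowMajorTail-empty w h (t ∸ 1) = z≤n
column+rowMajorTail≤rowMajorTail w (suc h) (suc q) n t (s≤s q≤h) 1+q≤1+w n≤ with n <? w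
... | yes n<w = begin
  span≥ 0 (suc q) t + rowMajorTail w (suc h) n (t ∸ 1)
    ≡⟨ cong (span≥ 0 (suc q) t +_) (rowMajorTail-one-row w h n (t ∸ 1) (<⇒≤ n<w)) ⟩
  span≥ 0 (suc q) t + span≥ 0 n (t ∸ 1)
    ≤⟨ column+row≤rowMajorTail w h (suc q) n t (s≤s z≤n) (s≤s q≤h) 1+q≤1+w n<w ⟩
  rowMajorTail (suc w) (suc h) (suc q + n) t ∎
  where open ≤-Reasoning
... | no  n≮w = begin
  span≥ 0 (suc q) t + rowMajorTail w (suc h) n (t ∸ 1)
    ≡⟨ cong₂ _+_ (cong (z +_) (span≥-suc 0 q t)) (rowMajorTail-full-row w h n (t ∸ 1) w≤n) ⟩
  (z + span≥ 0 q (t ∸ 1)) + (span≥ 0 w (t ∸ 1) + rowMajorTail w h (n ∸ w) (t ∸ 1 ∸ 1))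
    ≡⟨ interchange z (span≥ 0 q (t ∸ 1)) (span≥ 0 w (t ∸ 1)) _ ⟩
  (z + span≥ 0 w (t ∸ 1)) + (span≥ 0 q (t ∸ 1) + rowMajorTail w h (n ∸ w) (t ∸ 1 ∸ 1))
    ≤⟨ +-monoʳ-≤ (z + span≥ 0 w (t ∸ 1)) (column+rowMajorTail≤rowMajorTail w h q (n ∸ w) (t ∸ 1) q≤h
         (m≤n⇒m≤1+n (s≤s⁻¹ 1+q≤1+w)) (m≤n*[1+o]⇒m∸n≤n*o w q n≤)) ⟩
  (z + span≥ 0 w (t ∸ 1)) + rowMajorTail (suc w) h (q + (n ∸ w)) (t ∸ 1)
    ≡⟨ cong₂ _+_ (cong (z +_) (span≥-suc 0 w t))
                 (cong (λ x → rowMajorTail (suc w) h x (t ∸ 1)) (+-∸-assoc q w≤n)) ⟨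
  span≥ 0 (suc w) t + rowMajorTail (suc w) h (q + n ∸ w) (t ∸ 1)
    ≡⟨ rowMajorTail-full-row (suc w) h (suc q + n) t (s≤s (≤-trans w≤n (m≤n+m n q))) ⟨
  rowMajorTail (suc w) (suc h) (suc q + n) t ∎
  where
  open ≤-Reasoning
  z = [ t ≤ᵇ 0 ]
  w≤n : w ≤ n
  w≤n = ≮⇒≥ n≮w

-- Rank tails of shapes

Shape : Set
Shape = ℕ → ℕ → Bool

rankTail : ℕ → ℕ → Shape → ℕ → ℕ
rankTail W H S t = ∑ W (λ a → ∑ H (λ b → [ S a b ∧ (t ≤ᵇ a + b) ]))

size : ℕ → ℕ → Shape → ℕ
size W H S = rankTail W H S 0

InBox : ℕ → ℕ → Shape → Set
InBox W H S = ∀ a b → S a b ≡ true → a < W × b < H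

IsDownset : Shape → Set
IsDownset S = ∀ a b a′ b′ → a′ ≤ a → b′ ≤ b → S a b ≡ true → S a′ b′ ≡ true

RanksBelow : ℕ → ℕ → Shape → ℕ → Set
RanksBelow W H S t = ∀ a b → a < W → b < H → S a b ≡ true → a + b < t

Covers : ℕ → ℕ → Shape → ℕ → Set
Covers W H S T = ∀ a b → a < W → b < H → a + b < T → S a b ≡ true

dropColumn : Shape → Shape
dropColumn S a b = S (suc a) b

dropRow : Shape → Shape
dropRow S a b = S a (suc b)

transpose : Shape → Shape
transpose S a b = S b a

rankTail-cong : ∀ W H {S S′} t → (∀ a b → a < W → b < H → S a b ≡ S′ a b) →
  rankTail W H S t ≡ rankTail W H S′ t
rankTail-cong W H t S≗S′ =
  ∑-cong W (λ a a< → ∑-cong H (λ b b< → cong (λ x → [ x ∧ (t ≤ᵇ a + b) ]) (S≗S′ a b a< b<)))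

rankTail-dropColumn : ∀ W H S t →
  rankTail (suc W) H S t ≡ ∑ H (λ b → [ S 0 b ∧ (t ≤ᵇ b) ]) + rankTail W H (dropColumn S) (t ∸ 1)
rankTail-dropColumn W H S t = cong (∑ H (λ b → [ S 0 b ∧ (t ≤ᵇ b) ]) +_)
  (∑-cong W (λ a _ → ∑-cong H (λ b _ → cong (λ x → [ S (suc a) b ∧ x ]) (≤ᵇ-suc t (a + b)))))

rankTail-dropRow : ∀ W H S t →
  rankTail W (suc H) S t ≡ ∑ W (λ a → [ S a 0 ∧ (t ≤ᵇ a) ]) + rankTail W H (dropRow S) (t ∸ 1)
rankTail-dropRow W H S t = trans (∑-cong W (λ a _ → cong₂ _+_ (cong (λ x → [ S a 0 ∧ (t ≤ᵇ x) ]) (+-identityʳ a))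
    (∑-cong H (λ b _ → cong (λ x → [ S a (suc b) ∧ x ]) (shift a b)))))
  (∑-+ W _ _)
  where
  shift : ∀ a b → (t ≤ᵇ a + suc b) ≡ (t ∸ 1 ≤ᵇ a + b)
  shift a b = trans (cong (t ≤ᵇ_) (+-suc a b)) (≤ᵇ-suc t (a + b))

rankTail-transpose : ∀ W H S t → rankTail W H S t ≡ rankTail H W (transpose S) t
rankTail-transpose W H S t = trans (∑-comm W H _)
  (∑-cong H (λ b _ → ∑-cong W (λ a _ → cong (λ x → [ S a b ∧ (t ≤ᵇ x) ]) (+-comm a b))))

rankTail-≤-area : ∀ W H S t → rankTail W H S t ≤ W * H
rankTail-≤-area W H S t = ∑-≤-* W H (λ a _ → ∑[]≤ H (λ b → S a b ∧ (t ≤ᵇ a + b)))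

rankTail-height : ∀ W H q S t → q ≤ H → (∀ a b → S a b ≡ true → b < q) → rankTail W H S t ≡ rankTail W q S t
rankTail-height W H q S t q≤H below = ∑-cong W (λ a _ → ∑-vanishing-tail q H _ q≤H
  (λ b q≤b → [false∧] _ (¬-not (λ Sab → <⇒≱ (below a b Sab) q≤b))))

rankTail-width : ∀ W H q S t → q ≤ W → (∀ a b → S a b ≡ true → a < q) → rankTail W H S t ≡ rankTail q H S t
rankTail-width W H q S t q≤W left = ∑-vanishing-tail q W _ q≤W
  (λ a q≤a → ∑-zero H (λ b _ → [false∧] _ (¬-not (λ Sab → <⇒≱ (left a b Sab) q≤a))))

rankTail-zero : ∀ W H S t → RanksBelow W H S t → rankTail W H S t ≡ 0
rankTail-zero W H S t below = ∑-zero W (λ a a< → ∑-zero H (λ b b< → cell a b a< b<))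
  where
  cell : ∀ a b → a < W → b < H → [ S a b ∧ (t ≤ᵇ a + b) ] ≡ 0
  cell a b a< b< with S a b in Sab
  ... | false = refl
  ... | true  rewrite ≤ᵇ-false (below a b a< b< Sab) = refl

rankTail-positive : ∀ W H S t a b → a < W → b < H → S a b ≡ true → t ≤ a + b → 0 < rankTail W H S t
rankTail-positive W H S t a b a< b< Sab t≤ =
  ≤-trans cell (≤-trans (term≤∑ H (row a) b b<) (term≤∑ W (λ a → ∑ H (row a)) a a<))
  where
  row : ℕ → ℕ → ℕ
  row a b = [ S a b ∧ (t ≤ᵇ a + b) ]
  cell : 1 ≤ row a b
  cell rewrite Sab | ≤ᵇ-true t≤ = ≤-refl

inBox-dropColumn : ∀ {W H} S → InBox (suc W) H S → InBox W H (dropColumn S)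
inBox-dropColumn S box a b Sab with box (suc a) b Sab
... | s<s a<W , b<H = a<W , b<H

inBox-dropRow : ∀ {W H} S → InBox W (suc H) S → InBox W H (dropRow S)
inBox-dropRow S box a b Sab with box a (suc b) Sab
... | a<W , s<s b<H = a<W , b<H

inBox-transpose : ∀ {W H} S → InBox W H S → InBox H W (transpose S)
inBox-transpose S box a b Sba with box b a Sba
... | b<W , a<H = a<H , b<W

isDownset-dropColumn : ∀ S → IsDownset S → IsDownset (dropColumn S)
isDownset-dropColumn S down a b a′ b′ a′≤a b′≤b = down (suc a) b (suc a′) b′ (s≤s a′≤a) b′≤b

isDownset-dropRow : ∀ S → IsDownset S → IsDownset (dropRow S)
isDownset-dropRow S down a b a′ b′ a′≤a b′≤b = down a (suc b) a′ (suc b′) a′≤a (s≤s b′≤b)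

isDownset-transpose : ∀ S → IsDownset S → IsDownset (transpose S)
isDownset-transpose S down a b a′ b′ a′≤a b′≤b = down b a b′ a′ b′≤b a′≤a

DownClosed : (ℕ → Bool) → Set
DownClosed P = ∀ b → P (suc b) ≡ true → P b ≡ true

downClosed-false : ∀ P → DownClosed P → P 0 ≡ false → ∀ b → P b ≡ false
downClosed-false P down P0 zero    = P0
downClosed-false P down P0 (suc b) with P (suc b) in Pb+1
... | false = refl
... | true with () ← trans (sym (downClosed-false P down P0 b)) (down b Pb+1)

downClosed-zero : ∀ P → DownClosed P → ∀ b → P b ≡ true → P 0 ≡ true
downClosed-zero P down zero    Pb = Pb
downClosed-zero P down (suc b) Pb = downClosed-zero P down b (down b Pb)

∑-downClosed : ∀ P → DownClosed P → ∀ H lo t →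
  ∑ H (λ b → [ P b ∧ (t ≤ᵇ lo + b) ]) ≡ span≥ lo (∑ H (λ b → [ P b ])) t
∑-downClosed P down zero    lo t = refl
∑-downClosed P down (suc H) lo t with P 0 in P0
... | true  = cong ([ t ≤ᵇ lo + 0 ] +_) (begin
  ∑ H (λ b → [ P (suc b) ∧ (t ≤ᵇ lo + suc b) ])
    ≡⟨ ∑-cong H (λ b _ → cong (λ x → [ P (suc b) ∧ (t ≤ᵇ x) ]) (+-suc lo b)) ⟩
  ∑ H (λ b → [ P (suc b) ∧ (t ≤ᵇ suc lo + b) ])
    ≡⟨ ∑-downClosed (P ∘ suc) (down ∘ suc) H (suc lo) t ⟩
  span≥ (suc lo) q t
    ≡⟨ ∑-cong q (λ i _ → cong (λ x → [ t ≤ᵇ x ]) (+-suc lo i)) ⟨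
  ∑ q (λ i → [ t ≤ᵇ lo + suc i ]) ∎)
  where
  open ≡-Reasoning
  q = ∑ H (λ b → [ P (suc b) ])
... | false = trans (∑-zero H (λ b _ → [false∧] _ (Pfalse (suc b))))
                    (cong (λ x → span≥ lo x t) (sym (∑-zero H (λ b _ → cong [_] (Pfalse (suc b))))))
  where
  Pfalse : ∀ b → P b ≡ false
  Pfalse = downClosed-false P down P0

downClosed-member< : ∀ P → DownClosed P → ∀ H b → b < H → P b ≡ true → b < ∑ H (λ i → [ P i ])
downClosed-member< P down (suc H) zero    _         Pb rewrite Pb = s≤s z≤n
downClosed-member< P down (suc H) (suc b) (s<s b<H) Pb rewrite downClosed-zero P down (suc b) Pb =
  s≤s (downClosed-member< (P ∘ suc) (down ∘ suc) H b b<H Pb)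

size-dropColumn : ∀ W H S → IsDownset S → size (suc W) H S ≡ ∑ H (λ b → [ S 0 b ]) + size W H (dropColumn S)
size-dropColumn W H S down = trans (rankTail-dropColumn W H S 0) (cong (_+ size W H (dropColumn S))
  (trans (∑-downClosed (S 0) (λ b → down 0 (suc b) 0 b ≤-refl (n≤1+n b)) H 0 0) (span≥-zero 0 _)))

size-dropRow : ∀ W H S → IsDownset S → size W (suc H) S ≡ ∑ W (λ a → [ S a 0 ]) + size W H (dropRow S)
size-dropRow W H S down = trans (rankTail-dropRow W H S 0) (cong (_+ size W H (dropRow S))
  (trans (∑-downClosed (λ a → S a 0) (λ a → down (suc a) 0 a 0 (n≤1+n a) ≤-refl) W 0 0) (span≥-zero 0 _)))

-- Downsets are dominated by the row-major filling

RowMajorDominates : ℕ → ℕ → Set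
RowMajorDominates W H = ∀ S → InBox W H S → IsDownset S →
  ∀ t → rankTail W H S t ≤ rowMajorTail W H (size W H S) t

rowMajorDominates-suc-width : ∀ {W H} → H ≤ W → RowMajorDominates W H → RowMajorDominates (suc W) H
rowMajorDominates-suc-width {W} {H} H≤W dominates S box down t = begin
  rankTail (suc W) H S t
    ≡⟨ rankTail-dropColumn W H S t ⟩
  ∑ H (λ b → [ S 0 b ∧ (t ≤ᵇ b) ]) + rankTail W H (dropColumn S) (t ∸ 1)
    ≡⟨ cong (_+ rankTail W H (dropColumn S) (t ∸ 1)) (∑-downClosed (S 0) firstColumn-downClosed H 0 t) ⟩
  span≥ 0 q t + rankTail W H (dropColumn S) (t ∸ 1)
    ≤⟨ +-monoʳ-≤ (span≥ 0 q t)
         (dominates (dropColumn S) (inBox-dropColumn S box) (isDownset-dropColumn S down) (t ∸ 1)) ⟩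
  span≥ 0 q t + rowMajorTail W H n (t ∸ 1)
    ≤⟨ column+rowMajorTail≤rowMajorTail W H q n t q≤H (≤-trans q≤H (m≤n⇒m≤1+n H≤W)) n≤W*q ⟩
  rowMajorTail (suc W) H (q + n) t
    ≡⟨ cong (λ x → rowMajorTail (suc W) H x t) (size-dropColumn W H S down) ⟨
  rowMajorTail (suc W) H (size (suc W) H S) t ∎
  where
  open ≤-Reasoning
  q = ∑ H (λ b → [ S 0 b ])
  n = size W H (dropColumn S)
  firstColumn-downClosed : DownClosed (S 0)
  firstColumn-downClosed b = down 0 (suc b) 0 b ≤-refl (n≤1+n b)
  q≤H : q ≤ H
  q≤H = ∑[]≤ H (S 0)
  below-q : ∀ a b → dropColumn S a b ≡ true → b < q
  below-q a b Sa+1b = downClosed-member< (S 0) firstColumn-downClosed H b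
    (proj₂ (box (suc a) b Sa+1b)) (down (suc a) b 0 b z≤n ≤-refl Sa+1b)
  n≤W*q : n ≤ W * q
  n≤W*q = ≤-trans (≤-reflexive (rankTail-height W H q (dropColumn S) 0 q≤H below-q)) (rankTail-≤-area W q _ 0)

rowMajorDominates-full-row : ∀ W H → RowMajorDominates (suc W) H →
  ∀ S → InBox (suc W) (suc H) S → IsDownset S → S W 0 ≡ true →
  ∀ t → rankTail (suc W) (suc H) S t ≤ rowMajorTail (suc W) (suc H) (size (suc W) (suc H) S) t
rowMajorDominates-full-row W H dominates S box down SW0 t = begin
  rankTail (suc W) (suc H) S t
    ≡⟨ rankTail-dropRow (suc W) H S t ⟩
  ∑ (suc W) (λ a → [ S a 0 ∧ (t ≤ᵇ a) ]) + rankTail (suc W) H (dropRow S) (t ∸ 1)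
    ≡⟨ cong (_+ rankTail (suc W) H (dropRow S) (t ∸ 1)) (trans
         (∑-downClosed (λ a → S a 0) (λ a → down (suc a) 0 a 0 (n≤1+n a) ≤-refl) (suc W) 0 t)
         (cong (λ x → span≥ 0 x t) firstRow-full)) ⟩
  span≥ 0 (suc W) t + rankTail (suc W) H (dropRow S) (t ∸ 1)
    ≤⟨ +-monoʳ-≤ (span≥ 0 (suc W) t)
         (dominates (dropRow S) (inBox-dropRow S box) (isDownset-dropRow S down) (t ∸ 1)) ⟩
  span≥ 0 (suc W) t + rowMajorTail (suc W) H n (t ∸ 1)
    ≡⟨ cong (λ x → span≥ 0 (suc W) t + rowMajorTail (suc W) H x (t ∸ 1)) (m+n∸m≡n (suc W) n) ⟨
  span≥ 0 (suc W) t + rowMajorTail (suc W) H (suc W + n ∸ suc W) (t ∸ 1)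
    ≡⟨ rowMajorTail-full-row (suc W) H (suc W + n) t (m≤m+n (suc W) n) ⟨
  rowMajorTail (suc W) (suc H) (suc W + n) t
    ≡⟨ cong (λ x → rowMajorTail (suc W) (suc H) x t)
            (trans (size-dropRow (suc W) H S down) (cong (_+ n) firstRow-full)) ⟨
  rowMajorTail (suc W) (suc H) (size (suc W) (suc H) S) t ∎
  where
  open ≤-Reasoning
  n = size (suc W) H (dropRow S)
  firstRow-full : ∑ (suc W) (λ a → [ S a 0 ]) ≡ suc W
  firstRow-full = trans (∑-cong (suc W) (λ a a≤W → cong [_] (down W 0 a 0 (s≤s⁻¹ a≤W) ≤-refl SW0)))
                        (trans (∑-const (suc W) 1) (*-identityʳ (suc W)))

rowMajorDominates-square : ∀ W → RowMajorDominates (suc W) W → RowMajorDominates (suc W) (suc W)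
rowMajorDominates-square W dominates S box down t with S W 0 in SW0
... | true  = rowMajorDominates-full-row W W dominates S box down SW0 t
... | false = begin
  rankTail (suc W) (suc W) S t
    ≡⟨ as-transposed t ⟩
  rankTail (suc W) W (transpose S) t
    ≤⟨ dominates (transpose S) boxᵀ (isDownset-transpose S down) t ⟩
  rowMajorTail (suc W) W (size (suc W) W (transpose S)) t
    ≡⟨ rowMajorTail-suc-height (suc W) W _ t (rankTail-≤-area (suc W) W (transpose S) 0) ⟨
  rowMajorTail (suc W) (suc W) (size (suc W) W (transpose S)) t
    ≡⟨ cong (λ x → rowMajorTail (suc W) (suc W) x t) (as-transposed 0) ⟨
  rowMajorTail (suc W) (suc W) (size (suc W) (suc W) S) t ∎
  where
  open ≤-Reasoning
  left-of-W : ∀ a b → S a b ≡ true → a < W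
  left-of-W a b Sab with a <? W
  ... | yes a<W = a<W
  ... | no  a≮W with () ← trans (sym (down a b W 0 (≮⇒≥ a≮W) z≤n Sab)) SW0
  boxᵀ : InBox (suc W) W (transpose S)
  boxᵀ = inBox-transpose S (λ a b Sab → left-of-W a b Sab , proj₂ (box a b Sab))
  as-transposed : ∀ t → rankTail (suc W) (suc W) S t ≡ rankTail (suc W) W (transpose S) t
  as-transposed t = trans (rankTail-width (suc W) (suc W) W S t (n≤1+n W) left-of-W) (rankTail-transpose W (suc W) S t)

rowMajorDominates : ∀ {W H} → H ≤′ W → RowMajorDominates W H
rowMajorDominates {W} {zero}  _             S _ _ t = ≤-reflexive (∑-zero W (λ _ _ → refl))
rowMajorDominates {H = suc h} ≤′-refl       = rowMajorDominates-square h (rowMajorDominates (≤′-step ≤′-refl))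
rowMajorDominates {H = suc h} (≤′-step H≤W) = rowMajorDominates-suc-width (≤′⇒≤ H≤W) (rowMajorDominates H≤W)

-- Row-major versus column-major filling

rowMajor : ℕ → ℕ → Shape
rowMajor w m a b = (a <ᵇ w) ∧ (b * w + a <ᵇ m)

columnMajor : ℕ → ℕ → Shape
columnMajor h m = transpose (rowMajor h m)

rowMajor-rankTail : ∀ w h m t → rankTail w h (rowMajor w m) t ≡ rowMajorTail w h m t
rowMajor-rankTail w zero    m t = ∑-zero w (λ _ _ → refl)
rowMajor-rankTail w (suc h) m t = begin
  rankTail w (suc h) (rowMajor w m) t
    ≡⟨ rankTail-dropRow w h (rowMajor w m) t ⟩
  ∑ w (λ a → [ rowMajor w m a 0 ∧ (t ≤ᵇ a) ]) + rankTail w h (dropRow (rowMajor w m)) (t ∸ 1)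
    ≡⟨ cong₂ _+_ firstRow (rankTail-cong w h (t ∸ 1) (λ a b _ _ → cong ((a <ᵇ w) ∧_)
         (trans (cong (_<ᵇ m) (+-assoc w (b * w) a)) (<ᵇ-+ w (b * w + a) m)))) ⟩
  span≥ 0 (w ⊓ m) t + rankTail w h (rowMajor w (m ∸ w)) (t ∸ 1)
    ≡⟨ cong (span≥ 0 (w ⊓ m) t +_) (rowMajor-rankTail w h (m ∸ w) (t ∸ 1)) ⟩
  rowMajorTail w (suc h) m t ∎
  where
  open ≡-Reasoning
  firstRow : ∑ w (λ a → [ rowMajor w m a 0 ∧ (t ≤ᵇ a) ]) ≡ span≥ 0 (w ⊓ m) t
  firstRow = begin
    ∑ w (λ a → [ rowMajor w m a 0 ∧ (t ≤ᵇ a) ])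
      ≡⟨ ∑-cong w (λ a a<w → cong (λ x → [ (x ∧ (a <ᵇ m)) ∧ (t ≤ᵇ a) ]) (<ᵇ-true a<w)) ⟩
    ∑ w (λ a → [ (a <ᵇ m) ∧ (t ≤ᵇ a) ])
      ≡⟨ ∑-downClosed (_<ᵇ m) (λ a a+1<m → <ᵇ-true (<-trans (n<1+n a) (<ᵇ-sound (suc a) m a+1<m))) w 0 t ⟩
    span≥ 0 (∑ w (λ a → [ a <ᵇ m ])) t
      ≡⟨ cong (λ x → span≥ 0 x t) (∑-<ᵇ w m) ⟩
    span≥ 0 (w ⊓ m) t ∎

columnMajor-rankTail : ∀ w h m t → rankTail w h (columnMajor h m) t ≡ rowMajorTail h w m t
columnMajor-rankTail w h m t = trans (sym (rankTail-transpose h w (rowMajor h m) t)) (rowMajor-rankTail h w m t)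

size-rowMajor : ∀ w h m → m ≤ w * h → size w h (rowMajor w m) ≡ m
size-rowMajor w h m m≤wh = trans (rowMajor-rankTail w h m 0) (rowMajorTail-size w h m m≤wh)

size-columnMajor≡size-rowMajor : ∀ w h m → m ≤ w * h → size w h (columnMajor h m) ≡ size w h (rowMajor w m)
size-columnMajor≡size-rowMajor w h m m≤wh = begin
  size w h (columnMajor h m) ≡⟨ columnMajor-rankTail w h m 0 ⟩
  rowMajorTail h w m 0       ≡⟨ rowMajorTail-size h w m (≤-trans m≤wh (≤-reflexive (*-comm w h))) ⟩
  m                          ≡⟨ size-rowMajor w h m m≤wh ⟨
  size w h (rowMajor w m)    ∎
  where open ≡-Reasoning

isDownset-rowMajor : ∀ w m → IsDownset (rowMajor w m)
isDownset-rowMajor w m a b a′ b′ a′≤a b′≤b inS with ∧-true⁻ {a <ᵇ w} inS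
... | a<w , index<m = cong₂ _∧_ (<ᵇ-true (≤-<-trans a′≤a (<ᵇ-sound a w a<w)))
  (<ᵇ-true (≤-<-trans (+-mono-≤ (*-monoˡ-≤ w b′≤b) a′≤a) (<ᵇ-sound _ m index<m)))

rowMajor-index< : ∀ {a b w h} → a < w → b < h → b * w + a < w * h
rowMajor-index< {a} {b} {w} {h} a<w b<h = begin-strict
  b * w + a <⟨ +-monoʳ-< (b * w) a<w ⟩
  b * w + w ≡⟨ +-comm (b * w) w ⟩
  suc b * w ≤⟨ *-monoˡ-≤ w b<h ⟩
  h * w     ≡⟨ *-comm h w ⟩
  w * h     ∎
  where open ≤-Reasoning

rowMajor-full : ∀ {w h a b} → a < w → b < h → rowMajor w (w * h) a b ≡ true
rowMajor-full a<w b<h = cong₂ _∧_ (<ᵇ-true a<w) (<ᵇ-true (rowMajor-index< a<w b<h))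

rowMajor-previous-row-full : ∀ w m k → rowMajor (suc w) m 0 (suc k) ≡ true → rowMajor (suc w) m w k ≡ true
rowMajor-previous-row-full w m k started = cong₂ _∧_ (<ᵇ-true (n<1+n w)) (<ᵇ-true (begin-strict
  k * suc w + w     <⟨ +-monoʳ-< (k * suc w) ≤-refl ⟩
  k * suc w + suc w ≡⟨ +-comm (k * suc w) (suc w) ⟩
  suc k * suc w     ≡⟨ +-identityʳ _ ⟨
  suc k * suc w + 0 <⟨ <ᵇ-sound _ m started ⟩
  m                 ∎))
  where open ≤-Reasoning

rowMajorTail-one-row-transpose : ∀ w h m t → m ≤ suc w → m ≤ suc h →
  rowMajorTail (suc w) (suc h) m t ≡ rowMajorTail (suc h) (suc w) m t
rowMajorTail-one-row-transpose w h m t m≤1+w m≤1+h =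
  trans (rowMajorTail-one-row (suc w) h m t m≤1+w) (sym (rowMajorTail-one-row (suc h) w m t m≤1+h))

rowMajorTail-full-transpose : ∀ w h t → rowMajorTail w h (w * h) t ≡ rowMajorTail h w (h * w) t
rowMajorTail-full-transpose w h t = begin
  rowMajorTail w h (w * h) t                      ≡⟨ rowMajor-rankTail w h (w * h) t ⟨
  rankTail w h (rowMajor w (w * h)) t             ≡⟨ rankTail-transpose w h (rowMajor w (w * h)) t ⟩
  rankTail h w (transpose (rowMajor w (w * h))) t
    ≡⟨ rankTail-cong h w t (λ a b a<h b<w → trans (rowMajor-full b<w a<h) (sym (rowMajor-full a<h b<w))) ⟩
  rankTail h w (rowMajor h (h * w)) t             ≡⟨ rowMajor-rankTail h w (h * w) t ⟩
  rowMajorTail h w (h * w) t                      ∎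
  where open ≡-Reasoning

∸-comm : ∀ m n o → m ∸ n ∸ o ≡ m ∸ o ∸ n
∸-comm m n o = trans (∸-+-assoc m n o) (trans (cong (m ∸_) (+-comm n o)) (sym (∸-+-assoc m o n)))

-- The last e ≤ w cells of the full filling form the end of its top row, of ranks h + (w − e) onwards.
rowMajorTail-complement : ∀ w h e t → e ≤ w →
  rowMajorTail w (suc h) (w * suc h ∸ e) t + span≥ (h + (w ∸ e)) e t ≡ rowMajorTail w (suc h) (w * suc h) t
rowMajorTail-complement w zero e t e≤w rewrite *-identityʳ w = begin
  span≥ 0 (w ⊓ (w ∸ e)) t + 0 + span≥ (w ∸ e) e t
    ≡⟨ cong (λ x → span≥ 0 x t + 0 + span≥ (w ∸ e) e t) (m≥n⇒m⊓n≡n (m∸n≤m w e)) ⟩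
  span≥ 0 (w ∸ e) t + 0 + span≥ (w ∸ e) e t
    ≡⟨ cong (_+ span≥ (w ∸ e) e t) (+-identityʳ _) ⟩
  span≥ 0 (w ∸ e) t + span≥ (w ∸ e) e t
    ≡⟨ span≥-split 0 (w ∸ e) e t ⟨
  span≥ 0 (w ∸ e + e) t
    ≡⟨ cong (λ x → span≥ 0 x t) (trans (m∸n+n≡m e≤w) (sym (⊓-idem w))) ⟩
  span≥ 0 (w ⊓ w) t
    ≡⟨ +-identityʳ _ ⟨
  span≥ 0 (w ⊓ w) t + 0 ∎
  where open ≡-Reasoning
rowMajorTail-complement w (suc h) e t e≤w = begin
  rowMajorTail w (2 + h) (w * (2 + h) ∸ e) t + span≥ (suc h + (w ∸ e)) e t
    ≡⟨ cong₂ _+_ (rowMajorTail-full-row w (suc h) _ t w≤) (span≥-suc (h + (w ∸ e)) e t) ⟩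
  span≥ 0 w t + rowMajorTail w (suc h) (w * (2 + h) ∸ e ∸ w) (t ∸ 1) + X
    ≡⟨ +-assoc (span≥ 0 w t) _ X ⟩
  span≥ 0 w t + (rowMajorTail w (suc h) (w * (2 + h) ∸ e ∸ w) (t ∸ 1) + X)
    ≡⟨ cong (λ x → span≥ 0 w t + (rowMajorTail w (suc h) x (t ∸ 1) + X))
            (trans (∸-comm _ e w) (cong (_∸ e) drop-row)) ⟩
  span≥ 0 w t + (rowMajorTail w (suc h) (w * suc h ∸ e) (t ∸ 1) + X)
    ≡⟨ cong (span≥ 0 w t +_) (rowMajorTail-complement w h e (t ∸ 1) e≤w) ⟩
  span≥ 0 w t + rowMajorTail w (suc h) (w * suc h) (t ∸ 1)
    ≡⟨ cong (λ x → span≥ 0 w t + rowMajorTail w (suc h) x (t ∸ 1)) drop-row ⟨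
  span≥ 0 w t + rowMajorTail w (suc h) (w * (2 + h) ∸ w) (t ∸ 1)
    ≡⟨ rowMajorTail-full-row w (suc h) _ t (≤-trans w≤ (m∸n≤m _ e)) ⟨
  rowMajorTail w (2 + h) (w * (2 + h)) t ∎
  where
  open ≡-Reasoning
  X = span≥ (h + (w ∸ e)) e (t ∸ 1)
  drop-row : w * (2 + h) ∸ w ≡ w * suc h
  drop-row = trans (cong (_∸ w) (*-suc w (suc h))) (m+n∸m≡n w _)
  w≤ : w ≤ w * (2 + h) ∸ e
  w≤ = ≤-trans (≤-reflexive (sym (m+n∸n≡m w e))) (∸-monoˡ-≤ e
         (≤-trans (+-monoʳ-≤ w (≤-trans e≤w (m≤m*n w (suc h)))) (≤-reflexive (sym (*-suc w (suc h))))))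

rowMajorTail-almost-full-transpose : ∀ w h e t → e ≤ suc w → e ≤ suc h →
  rowMajorTail (suc w) (suc h) (suc w * suc h ∸ e) t ≡ rowMajorTail (suc h) (suc w) (suc w * suc h ∸ e) t
rowMajorTail-almost-full-transpose w h e t e≤1+w e≤1+h = +-cancelʳ-≡ X _ _ (begin
  rowMajorTail (suc w) (suc h) (suc w * suc h ∸ e) t + X
    ≡⟨ rowMajorTail-complement (suc w) h e t e≤1+w ⟩
  rowMajorTail (suc w) (suc h) (suc w * suc h) t
    ≡⟨ rowMajorTail-full-transpose (suc w) (suc h) t ⟩
  rowMajorTail (suc h) (suc w) (suc h * suc w) t
    ≡⟨ rowMajorTail-complement (suc h) w e t e≤1+h ⟨
  rowMajorTail (suc h) (suc w) (suc h * suc w ∸ e) t + span≥ (w + (suc h ∸ e)) e t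
    ≡⟨ cong₂ (λ m lo → rowMajorTail (suc h) (suc w) (m ∸ e) t + span≥ lo e t) (*-comm (suc h) (suc w)) corner ⟩
  rowMajorTail (suc h) (suc w) (suc w * suc h ∸ e) t + X ∎)
  where
  open ≡-Reasoning
  X = span≥ (h + (suc w ∸ e)) e t
  corner : w + (suc h ∸ e) ≡ h + (suc w ∸ e)
  corner = begin
    w + (suc h ∸ e) ≡⟨ +-∸-assoc w e≤1+h ⟨
    w + suc h ∸ e   ≡⟨ cong (_∸ e) (trans (+-suc w h) (sym (trans (+-suc h w) (cong suc (+-comm h w))))) ⟩
    h + suc w ∸ e   ≡⟨ +-∸-assoc h e≤1+w ⟩
    h + (suc w ∸ e) ∎

rowMajorTail-transpose : ∀ w h m → h ≤ w → m ≤ suc w * suc h → m ≤ suc h ⊎ suc h * w ≤ m →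
  ∀ t → rowMajorTail (suc h) (suc w) m t ≡ rowMajorTail (suc w) (suc h) m t
rowMajorTail-transpose w h m h≤w _ (inj₁ m≤1+h) t =
  sym (rowMajorTail-one-row-transpose w h m t (≤-trans m≤1+h (s≤s h≤w)) m≤1+h)
rowMajorTail-transpose w h m h≤w m≤area (inj₂ area-h≤m) t =
  subst (λ k → rowMajorTail (suc h) (suc w) k t ≡ rowMajorTail (suc w) (suc h) k t) (m∸[m∸n]≡n m≤area)
    (sym (rowMajorTail-almost-full-transpose w h e t (≤-trans e≤1+h (s≤s h≤w)) e≤1+h))
  where
  e = suc w * suc h ∸ m
  e≤1+h : e ≤ suc h
  e≤1+h = begin
    suc w * suc h ∸ m             ≤⟨ ∸-monoʳ-≤ (suc w * suc h) area-h≤m ⟩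
    suc w * suc h ∸ suc h * w     ≡⟨ cong (λ x → suc h + x ∸ suc h * w) (*-comm w (suc h)) ⟩
    suc h + suc h * w ∸ suc h * w ≡⟨ m+n∸n≡m (suc h) (suc h * w) ⟩
    suc h                         ∎
    where open ≤-Reasoning

rankHead : ℕ → ℕ → Shape → ℕ → ℕ
rankHead W H S T = ∑ W (λ a → ∑ H (λ b → [ S a b ∧ (a + b <ᵇ T) ]))

size≡rankTail+rankHead : ∀ W H S T → size W H S ≡ rankTail W H S T + rankHead W H S T
size≡rankTail+rankHead W H S T =
  trans (∑-cong W (λ a _ → trans (∑-cong H (λ b _ → cell a b)) (∑-+ H _ _))) (∑-+ W _ _)
  where
  cell : ∀ a b → [ S a b ∧ (0 ≤ᵇ a + b) ] ≡ [ S a b ∧ (T ≤ᵇ a + b) ] + [ S a b ∧ (a + b <ᵇ T) ]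
  cell a b with S a b
  ... | true  = sym ([≤ᵇ]+[<ᵇ] T (a + b))
  ... | false = refl

rankHead-< : ∀ W H L C T c d → Covers W H L T → c < W → d < H → c + d < T → C c d ≡ false →
  rankHead W H C T < rankHead W H L T
rankHead-< W H L C T c d covers c<W d<H c+d<T hole =
  ∑-mono-< W (λ a a<W → ∑-mono-≤ H (λ b b<H → cell≤ a b a<W b<H)) c c<W
    (∑-mono-< H (λ b b<H → cell≤ c b c<W b<H) d d<H cell<)
  where
  cell≤ : ∀ a b → a < W → b < H → [ C a b ∧ (a + b <ᵇ T) ] ≤ [ L a b ∧ (a + b <ᵇ T) ]
  cell≤ a b a<W b<H = [∧]-mono (C a b) (L a b) (a + b <ᵇ T) (covers a b a<W b<H ∘ <ᵇ-sound (a + b) T)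
  cell< : [ C c d ∧ (c + d <ᵇ T) ] < [ L c d ∧ (c + d <ᵇ T) ]
  cell< rewrite hole | covers c d c<W d<H c+d<T | <ᵇ-true c+d<T = ≤-refl

rankTail-<-of-hole : ∀ W H L C T c d → size W H L ≡ size W H C → Covers W H L T →
  c < W → d < H → c + d < T → C c d ≡ false → rankTail W H L T < rankTail W H C T
rankTail-<-of-hole W H L C T c d same-size covers c<W d<H c+d<T hole =
  +-cancelʳ-< (rankHead W H L T) (rankTail W H L T) (rankTail W H C T) (begin-strict
    rankTail W H L T + rankHead W H L T ≡⟨ size≡rankTail+rankHead W H L T ⟨
    size W H L                          ≡⟨ same-size ⟩
    size W H C                          ≡⟨ size≡rankTail+rankHead W H C T ⟩
    rankTail W H C T + rankHead W H C T
      <⟨ +-monoʳ-< (rankTail W H C T) (rankHead-< W H L C T c d covers c<W d<H c+d<T hole) ⟩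
    rankTail W H C T + rankHead W H L T ∎)
  where open ≤-Reasoning

rankTail-<-of-top : ∀ W H L C t a b → RanksBelow W H L t → a < W → b < H → C a b ≡ true → t ≤ a + b →
  rankTail W H L t < rankTail W H C t
rankTail-<-of-top W H L C t a b below a<W b<H Cab t≤ =
  subst (_< rankTail W H C t) (sym (rankTail-zero W H L t below)) (rankTail-positive W H C t a b a<W b<H Cab t≤)

columnMajor-full-columns : ∀ h q p a b → a < p → b < suc h → columnMajor (suc h) (q + p * suc h) a b ≡ true
columnMajor-full-columns h q p a b a<p b≤h = cong₂ _∧_ (<ᵇ-true b≤h) (<ᵇ-true (begin-strict
  a * suc h + b <⟨ rowMajor-index< b≤h a<p ⟩
  suc h * p     ≡⟨ *-comm (suc h) p ⟩
  p * suc h     ≤⟨ m≤n+m (p * suc h) q ⟩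
  q + p * suc h ∎))
  where open ≤-Reasoning

columnMajor-covers-columns : ∀ W h q p → Covers W (suc h) (columnMajor (suc h) (q + p * suc h)) p
columnMajor-covers-columns W h q p a b _ b≤h a+b<p =
  columnMajor-full-columns h q p a b (≤-<-trans (m≤m+n a b) a+b<p) b≤h

columnMajor-covers-partial-column : ∀ W h q p → Covers W (suc h) (columnMajor (suc h) (suc q + p * suc h)) (suc p)
columnMajor-covers-partial-column W h q p a b _ b≤h a+b≤p
  with m≤n⇒m<n∨m≡n (≤-trans (m≤m+n a b) (s≤s⁻¹ a+b≤p))
... | inj₁ a<p = columnMajor-full-columns h (suc q) p a b a<p b≤h
... | inj₂ refl with n≤0⇒n≡0 (+-cancelˡ-≤ a b 0 (≤-trans (s≤s⁻¹ a+b≤p) (≤-reflexive (sym (+-identityʳ a)))))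
...   | refl = cong₂ _∧_ (<ᵇ-true {0} {suc h} (s≤s z≤n))
                         (<ᵇ-true (s≤s (≤-trans (≤-reflexive (+-identityʳ (a * suc h))) (m≤n+m _ q))))

columnMajor-ranksBelow : ∀ W h q p → q ≤ h → RanksBelow W (suc h) (columnMajor (suc h) (q + p * suc h)) (p + h)
columnMajor-ranksBelow W h q p q≤h a b _ b≤h inL = rank< (m≤n⇒m<n∨m≡n a≤p)
  where
  index< : a * suc h + b < q + p * suc h
  index< = <ᵇ-sound _ _ (proj₂ (∧-true⁻ {b <ᵇ suc h} inL))
  a≤p : a ≤ p
  a≤p = ≮⇒≥ (λ p<a → <⇒≱ index< (begin
    q + p * suc h   ≤⟨ +-monoˡ-≤ (p * suc h) q≤h ⟩
    h + p * suc h   ≤⟨ n≤1+n _ ⟩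
    suc p * suc h   ≤⟨ *-monoˡ-≤ (suc h) p<a ⟩
    a * suc h       ≤⟨ m≤m+n (a * suc h) b ⟩
    a * suc h + b   ∎))
    where open ≤-Reasoning
  rank< : a < p ⊎ a ≡ p → a + b < p + h
  rank< (inj₁ a<p)  = +-mono-<-≤ a<p (s≤s⁻¹ b≤h)
  rank< (inj₂ refl) = +-monoʳ-< a (<-≤-trans (+-cancelʳ-< (a * suc h) b q
                        (subst (_< q + a * suc h) (+-comm (a * suc h) b) index<)) q≤h)

-- Test the cell (0, j) with j = min(u + 1, h): either the row-major filling misses it although its rank
-- is below 2 + u, or it contains it and hence the whole row j − 1, whose last cell (w, j − 1) has rank at
-- least p + h, which no cell of the column-major filling reaches.
columnMajor-<-rowMajor : ∀ w h m q p u → 1 ≤ h → 2 + h ≤ w → p < w →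
  m ≡ q + p * suc h → q ≤ h → p ≤ 2 + u → Covers (suc w) (suc h) (columnMajor (suc h) m) (2 + u) →
  ∃[ t ] rankTail (suc w) (suc h) (columnMajor (suc h) m) t < rankTail (suc w) (suc h) (rowMajor (suc w) m) t
columnMajor-<-rowMajor w h@(suc h′) m q p u _ 2+h≤w p<w m≡ q≤h p≤2+u covers = separate _ refl
  where
  L = columnMajor (suc h) m
  C = rowMajor (suc w) m
  j = suc (u ⊓ h′)
  m≤area : m ≤ suc w * suc h
  m≤area = begin
    m                 ≡⟨ m≡ ⟩
    q + p * suc h     ≤⟨ +-monoˡ-≤ (p * suc h) (m≤n⇒m≤1+n q≤h) ⟩
    suc h + p * suc h ≤⟨ *-monoˡ-≤ (suc h) (m<n⇒m<1+n p<w) ⟩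
    suc w * suc h     ∎
    where open ≤-Reasoning
  top-rank : p + h ≤ w + (u ⊓ h′)
  top-rank = subst (p + h ≤_) (sym (+-distribˡ-⊓ w u h′)) (⊓-glb
    (≤-trans (+-monoˡ-≤ h p≤2+u) (≤-trans (≤-reflexive (reorder u h)) (+-monoˡ-≤ u 2+h≤w)))
    (≤-trans (≤-reflexive (+-suc p h′)) (+-monoˡ-≤ h′ p<w)))
    where
    reorder : ∀ u h → 2 + u + h ≡ 2 + h + u
    reorder = solve-∀
  separate : ∀ b → C 0 j ≡ b → ∃[ t ] rankTail (suc w) (suc h) L t < rankTail (suc w) (suc h) C t
  separate false hole    = 2 + u , rankTail-<-of-hole (suc w) (suc h) L C (2 + u) 0 j
    (size-columnMajor≡size-rowMajor (suc w) (suc h) m m≤area) covers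
    (s≤s z≤n) (s≤s (s≤s (m⊓n≤n u h′))) (s≤s (s≤s (m⊓n≤m u h′))) hole
  separate true  started = p + h , rankTail-<-of-top (suc w) (suc h) L C (p + h) w (u ⊓ h′)
    (subst (λ k → RanksBelow (suc w) (suc h) (columnMajor (suc h) k) (p + h)) (sym m≡)
           (columnMajor-ranksBelow (suc w) h q p q≤h))
    ≤-refl (s≤s (≤-trans (m⊓n≤n u h′) (n≤1+n h′)))
    (rowMajor-previous-row-full w m (u ⊓ h′) started) top-rank

rowMajorTail-transpose-< : ∀ w h m → 1 ≤ h → 2 + h ≤ w → suc h < m → m < suc h * w →
  ∃[ t ] rowMajorTail (suc h) (suc w) m t < rowMajorTail (suc w) (suc h) m t
rowMajorTail-transpose-< w h m 1≤h 2+h≤w h<m m<area =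
  map₂ (λ {t} → subst₂ _<_ (columnMajor-rankTail (suc w) (suc h) m t) (rowMajor-rankTail (suc w) (suc h) m t))
       (by-cases (m % suc h) (m / suc h) (m≡m%n+[m/n]*n m (suc h)) (s≤s⁻¹ (m%n<n m (suc h))))
  where
  p<w : ∀ q p → m ≡ q + p * suc h → p < w
  p<w q p m≡ = *-cancelʳ-< (suc h) p w (begin-strict
    p * suc h     ≤⟨ m≤n+m (p * suc h) q ⟩
    q + p * suc h ≡⟨ m≡ ⟨
    m             <⟨ m<area ⟩
    suc h * w     ≡⟨ *-comm (suc h) w ⟩
    w * suc h     ∎)
    where open ≤-Reasoning
  covers : ∀ {m′ T} → m ≡ m′ → Covers (suc w) (suc h) (columnMajor (suc h) m′) T →
    Covers (suc w) (suc h) (columnMajor (suc h) m) T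
  covers m≡ = subst (λ k → Covers (suc w) (suc h) (columnMajor (suc h) k) _) (sym m≡)
  by-cases : ∀ q p → m ≡ q + p * suc h → q ≤ h →
    ∃[ t ] rankTail (suc w) (suc h) (columnMajor (suc h) m) t < rankTail (suc w) (suc h) (rowMajor (suc w) m) t
  by-cases q       zero          m≡ q≤h =
    contradiction (≤-trans h<m (≤-reflexive (trans m≡ (+-identityʳ q)))) (<⇒≱ (s≤s (m≤n⇒m≤1+n q≤h)))
  by-cases zero    (suc zero)    m≡ q≤h = contradiction (trans m≡ (+-identityʳ (suc h))) (<⇒≢ h<m ∘ sym)
  by-cases zero    (suc (suc u)) m≡ q≤h =
    columnMajor-<-rowMajor w h m zero (2 + u) u 1≤h 2+h≤w (p<w zero (2 + u) m≡) m≡ q≤h ≤-refl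
      (covers m≡ (columnMajor-covers-columns (suc w) h zero (2 + u)))
  by-cases (suc q) (suc u)       m≡ q≤h =
    columnMajor-<-rowMajor w h m (suc q) (suc u) u 1≤h 2+h≤w (p<w (suc q) (suc u) m≡) m≡ q≤h (n≤1+n (suc u))
      (covers m≡ (columnMajor-covers-partial-column (suc w) h q (suc u)))

sumFinℕ-cong : ∀ n {f g : Fin n → ℕ} → (∀ i → f i ≡ g i) → sumFinℕ f ≡ sumFinℕ g
sumFinℕ-cong zero    _   = refl
sumFinℕ-cong (suc n) f≗g = cong₂ _+_ (f≗g Fin.zero) (sumFinℕ-cong n (f≗g ∘ Fin.suc))

sumFinℕ-toℕ : ∀ n (f : ℕ → ℕ) → sumFinℕ {n} (f ∘ toℕ) ≡ ∑ n f
sumFinℕ-toℕ zero    f = refl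
sumFinℕ-toℕ (suc n) f = cong (f 0 +_) (sumFinℕ-toℕ n (f ∘ suc))

card-∑ : ∀ {ℓ₁ ℓ₂} (S : Shape) →
  card {ℓ₁} {ℓ₂} (λ (i , j) → S (toℕ i) (toℕ j)) ≡ ∑ ℓ₁ (λ a → ∑ ℓ₂ (λ b → [ S a b ]))
card-∑ {ℓ₁} {ℓ₂} S = trans (sumFinℕ-cong ℓ₁ (λ i → sumFinℕ-toℕ ℓ₂ (λ b → [ S (toℕ i) b ])))
                           (sumFinℕ-toℕ ℓ₁ (λ a → ∑ ℓ₂ (λ b → [ S a b ])))

module _ {ℓ₁ ℓ₂ : ℕ} where

  toShape : Subset ℓ₁ ℓ₂ → Shape
  toShape S a b with a <? ℓ₁ | b <? ℓ₂
  ... | yes a<ℓ₁ | yes b<ℓ₂ = S (fromℕ< a<ℓ₁ , fromℕ< b<ℓ₂)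
  ... | yes _    | no  _    = false
  ... | no  _    | _        = false

  fromShape : Shape → Subset ℓ₁ ℓ₂
  fromShape X (i , j) = X (toℕ i) (toℕ j)

  toShape-inBox : ∀ S → InBox ℓ₁ ℓ₂ (toShape S)
  toShape-inBox S a b inS with a <? ℓ₁ | b <? ℓ₂
  ... | yes a<ℓ₁ | yes b<ℓ₂ = a<ℓ₁ , b<ℓ₂

  toShape-fromℕ< : ∀ S {a b} (a<ℓ₁ : a < ℓ₁) (b<ℓ₂ : b < ℓ₂) →
    toShape S a b ≡ S (fromℕ< a<ℓ₁ , fromℕ< b<ℓ₂)
  toShape-fromℕ< S {a} {b} a<ℓ₁ b<ℓ₂ with a <? ℓ₁ | b <? ℓ₂
  ... | yes _    | yes _    = refl
  ... | yes _    | no  b≮ℓ₂ = contradiction b<ℓ₂ b≮ℓ₂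
  ... | no  a≮ℓ₁ | _        = contradiction a<ℓ₁ a≮ℓ₁

  toShape-toℕ : ∀ S (i : Fin ℓ₁) (j : Fin ℓ₂) → toShape S (toℕ i) (toℕ j) ≡ S (i , j)
  toShape-toℕ S i j = trans (toShape-fromℕ< S (toℕ<n i) (toℕ<n j))
                            (cong₂ (λ x y → S (x , y)) (fromℕ<-toℕ i (toℕ<n i)) (fromℕ<-toℕ j (toℕ<n j)))

  toShape-isDownset : ∀ S → Downset S → IsDownset (toShape S)
  toShape-isDownset S down a b a′ b′ a′≤a b′≤b inS with toShape-inBox S a b inS
  ... | a<ℓ₁ , b<ℓ₂ = trans (toShape-fromℕ< S a′<ℓ₁ b′<ℓ₂)
    (down _ _ (subst₂ _≤_ (sym (toℕ-fromℕ< a′<ℓ₁)) (sym (toℕ-fromℕ< a<ℓ₁)) a′≤a ,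
               subst₂ _≤_ (sym (toℕ-fromℕ< b′<ℓ₂)) (sym (toℕ-fromℕ< b<ℓ₂)) b′≤b)
              (trans (sym (toShape-fromℕ< S a<ℓ₁ b<ℓ₂)) inS))
    where
    a′<ℓ₁ = ≤-<-trans a′≤a a<ℓ₁
    b′<ℓ₂ = ≤-<-trans b′≤b b<ℓ₂

  fromShape-downset : ∀ X → IsDownset X → Downset (fromShape X)
  fromShape-downset X down (i′ , j′) (i , j) (i′≤i , j′≤j) =
    down (toℕ i) (toℕ j) (toℕ i′) (toℕ j′) i′≤i j′≤j

  rankTailᶠ : Subset ℓ₁ ℓ₂ → ℕ → ℕ
  rankTailᶠ S t = card (λ x → S x ∧ (t ≤ᵇ rank x))

  rankTailᶠ-zero : ∀ S → rankTailᶠ S 0 ≡ card S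
  rankTailᶠ-zero S = sumFinℕ-cong ℓ₁ (λ i → sumFinℕ-cong ℓ₂ (λ j → cong [_] (∧-identityʳ (S (i , j)))))

  rankTailᶠ-toShape : ∀ S t → rankTailᶠ S t ≡ rankTail ℓ₁ ℓ₂ (toShape S) t
  rankTailᶠ-toShape S t = trans
    (sumFinℕ-cong ℓ₁ (λ i → sumFinℕ-cong ℓ₂ (λ j →
      cong (λ x → [ x ∧ (t ≤ᵇ toℕ i + toℕ j) ]) (sym (toShape-toℕ S i j)))))
    (card-∑ {ℓ₁} {ℓ₂} (λ a b → toShape S a b ∧ (t ≤ᵇ a + b)))

  rankTailᶠ-fromShape : ∀ X t → rankTailᶠ (fromShape X) t ≡ rankTail ℓ₁ ℓ₂ X t
  rankTailᶠ-fromShape X t = card-∑ {ℓ₁} {ℓ₂} (λ a b → X a b ∧ (t ≤ᵇ a + b))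

  card≡size : ∀ S → card S ≡ size ℓ₁ ℓ₂ (toShape S)
  card≡size S = trans (sym (rankTailᶠ-zero S)) (rankTailᶠ-toShape S 0)

  card≤area : ∀ S → card S ≤ ℓ₁ * ℓ₂
  card≤area S = ≤-trans (≤-reflexive (card≡size S)) (rankTail-≤-area ℓ₁ ℓ₂ (toShape S) 0)

  rankTailᶠ-≤-rowMajorTail : ℓ₂ ≤ ℓ₁ → ∀ B → Downset B →
    ∀ t → rankTailᶠ B t ≤ rowMajorTail ℓ₁ ℓ₂ (card B) t
  rankTailᶠ-≤-rowMajorTail ℓ₂≤ℓ₁ B down t = begin
    rankTailᶠ B t
      ≡⟨ rankTailᶠ-toShape B t ⟩
    rankTail ℓ₁ ℓ₂ (toShape B) t
      ≤⟨ rowMajorDominates (≤⇒≤′ ℓ₂≤ℓ₁) (toShape B) (toShape-inBox B) (toShape-isDownset B down) t ⟩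
    rowMajorTail ℓ₁ ℓ₂ (size ℓ₁ ℓ₂ (toShape B)) t
      ≡⟨ cong (λ m → rowMajorTail ℓ₁ ℓ₂ m t) (card≡size B) ⟨
    rowMajorTail ℓ₁ ℓ₂ (card B) t ∎
    where open ≤-Reasoning

[∨∧] : ∀ p q c → [ p ∨ (q ∧ c) ] ≡ (if p then 1 else if q then [ c ] else 0)
[∨∧] true  q     c = refl
[∨∧] false true  c = refl
[∨∧] false false c = refl

∑-lex : ∀ n A X Y → A < n → ∑ n (λ a → if a <ᵇ A then X else if a ≡ᵇ A then Y else 0) ≡ A * X + Y
∑-lex (suc n) zero    X Y _         = trans (cong (Y +_) (∑-zero n (λ _ _ → refl))) (+-identityʳ Y)
∑-lex (suc n) (suc A) X Y (s<s A<n) = trans (cong (X +_) (∑-lex n A X Y A<n)) (sym (+-assoc X (A * X) Y))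

∑-column-below-L : ∀ n p q J → J ≤ n →
  ∑ n (λ b → [ p ∨ (q ∧ (b <ᵇ J)) ]) ≡ (if p then n else if q then J else 0)
∑-column-below-L n true  q     J _   = trans (∑-const n 1) (*-identityʳ n)
∑-column-below-L n false true  J J≤n = ∑-<ᵇ-≤ n J J≤n
∑-column-below-L n false false J _   = ∑-zero n (λ _ _ → refl)

card-below-C : ∀ {ℓ₁ ℓ₂} (i : Fin ℓ₁) (j : Fin ℓ₂) → card (below _<C_ (i , j)) ≡ toℕ j * ℓ₁ + toℕ i
card-below-C {ℓ₁} {ℓ₂} i j = begin
  card (below _<C_ (i , j))
    ≡⟨ card-∑ {ℓ₁} {ℓ₂} (λ a b → (b <ᵇ J) ∨ ((b ≡ᵇ J) ∧ (a <ᵇ I))) ⟩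
  ∑ ℓ₁ (λ a → ∑ ℓ₂ (λ b → [ (b <ᵇ J) ∨ ((b ≡ᵇ J) ∧ (a <ᵇ I)) ]))
    ≡⟨ ∑-cong ℓ₁ (λ a _ → trans (∑-cong ℓ₂ (λ b _ → [∨∧] (b <ᵇ J) (b ≡ᵇ J) (a <ᵇ I)))
                                (∑-lex ℓ₂ J 1 _ (toℕ<n j))) ⟩
  ∑ ℓ₁ (λ a → J * 1 + [ a <ᵇ I ])
    ≡⟨ ∑-+ ℓ₁ (λ _ → J * 1) (λ a → [ a <ᵇ I ]) ⟩
  ∑ ℓ₁ (λ _ → J * 1) + ∑ ℓ₁ (λ a → [ a <ᵇ I ])
    ≡⟨ cong₂ _+_ (trans (∑-const ℓ₁ (J * 1)) (trans (cong (ℓ₁ *_) (*-identityʳ J)) (*-comm ℓ₁ J)))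
                 (∑-<ᵇ-≤ ℓ₁ I (<⇒≤ (toℕ<n i))) ⟩
  J * ℓ₁ + I ∎
  where
  open ≡-Reasoning
  I = toℕ i
  J = toℕ j

card-below-L : ∀ {ℓ₁ ℓ₂} (i : Fin ℓ₁) (j : Fin ℓ₂) → card (below _<L_ (i , j)) ≡ toℕ i * ℓ₂ + toℕ j
card-below-L {ℓ₁} {ℓ₂} i j = begin
  card (below _<L_ (i , j))
    ≡⟨ card-∑ {ℓ₁} {ℓ₂} (λ a b → (a <ᵇ I) ∨ ((a ≡ᵇ I) ∧ (b <ᵇ J))) ⟩
  ∑ ℓ₁ (λ a → ∑ ℓ₂ (λ b → [ (a <ᵇ I) ∨ ((a ≡ᵇ I) ∧ (b <ᵇ J)) ]))
    ≡⟨ ∑-cong ℓ₁ (λ a _ → ∑-column-below-L ℓ₂ (a <ᵇ I) (a ≡ᵇ I) J (<⇒≤ (toℕ<n j))) ⟩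
  ∑ ℓ₁ (λ a → if a <ᵇ I then ℓ₂ else if a ≡ᵇ I then J else 0)
    ≡⟨ ∑-lex ℓ₁ I ℓ₂ J (toℕ<n i) ⟩
  I * ℓ₂ + J ∎
  where
  open ≡-Reasoning
  I = toℕ i
  J = toℕ j

initialSegment-<ᵇ : ∀ {ℓ₁ ℓ₂} {_≺_ : Pt ℓ₁ ℓ₂ → Pt ℓ₁ ℓ₂ → Bool} {m S} → InitialSegment _≺_ m S →
  ∀ x → S x ≡ (card (below _≺_ x) <ᵇ m)
initialSegment-<ᵇ {_≺_ = _≺_} {m} {S} segment x =
  ≡-<ᵇ (S x) (card (below _≺_ x)) m (proj₁ (segment x)) (proj₂ (segment x))

module _ {ℓ₁ ℓ₂ : ℕ} (A : Subset ℓ₁ ℓ₂) where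

  rankTailᶠ-initialSegment-C : InitialSegment _<C_ (card A) A →
    ∀ t → rankTailᶠ A t ≡ rowMajorTail ℓ₁ ℓ₂ (card A) t
  rankTailᶠ-initialSegment-C segment t = begin
    rankTailᶠ A t                              ≡⟨ rankTailᶠ-toShape A t ⟩
    rankTail ℓ₁ ℓ₂ (toShape A) t               ≡⟨ rankTail-cong ℓ₁ ℓ₂ t toShape≡rowMajor ⟩
    rankTail ℓ₁ ℓ₂ (rowMajor ℓ₁ (card A)) t    ≡⟨ rowMajor-rankTail ℓ₁ ℓ₂ (card A) t ⟩
    rowMajorTail ℓ₁ ℓ₂ (card A) t              ∎
    where
    open ≡-Reasoning
    toShape≡rowMajor : ∀ a b → a < ℓ₁ → b < ℓ₂ → toShape A a b ≡ rowMajor ℓ₁ (card A) a b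
    toShape≡rowMajor a b a<ℓ₁ b<ℓ₂ = begin
      toShape A a b                                  ≡⟨ toShape-fromℕ< A a<ℓ₁ b<ℓ₂ ⟩
      A (fromℕ< a<ℓ₁ , fromℕ< b<ℓ₂)                  ≡⟨ initialSegment-<ᵇ segment _ ⟩
      card (below _<C_ (fromℕ< a<ℓ₁ , fromℕ< b<ℓ₂)) <ᵇ card A
        ≡⟨ cong (_<ᵇ card A) (trans (card-below-C (fromℕ< a<ℓ₁) (fromℕ< b<ℓ₂))
             (cong₂ (λ u v → u * ℓ₁ + v) (toℕ-fromℕ< b<ℓ₂) (toℕ-fromℕ< a<ℓ₁))) ⟩
      b * ℓ₁ + a <ᵇ card A                           ≡⟨ cong (_∧ (b * ℓ₁ + a <ᵇ card A)) (<ᵇ-true a<ℓ₁) ⟨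
      rowMajor ℓ₁ (card A) a b                       ∎

  rankTailᶠ-initialSegment-L : InitialSegment _<L_ (card A) A →
    ∀ t → rankTailᶠ A t ≡ rowMajorTail ℓ₂ ℓ₁ (card A) t
  rankTailᶠ-initialSegment-L segment t = begin
    rankTailᶠ A t                              ≡⟨ rankTailᶠ-toShape A t ⟩
    rankTail ℓ₁ ℓ₂ (toShape A) t               ≡⟨ rankTail-cong ℓ₁ ℓ₂ t toShape≡columnMajor ⟩
    rankTail ℓ₁ ℓ₂ (columnMajor ℓ₂ (card A)) t ≡⟨ columnMajor-rankTail ℓ₁ ℓ₂ (card A) t ⟩
    rowMajorTail ℓ₂ ℓ₁ (card A) t              ∎
    where
    open ≡-Reasoning
    toShape≡columnMajor : ∀ a b → a < ℓ₁ → b < ℓ₂ → toShape A a b ≡ columnMajor ℓ₂ (card A) a b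
    toShape≡columnMajor a b a<ℓ₁ b<ℓ₂ = begin
      toShape A a b                                  ≡⟨ toShape-fromℕ< A a<ℓ₁ b<ℓ₂ ⟩
      A (fromℕ< a<ℓ₁ , fromℕ< b<ℓ₂)                  ≡⟨ initialSegment-<ᵇ segment _ ⟩
      card (below _<L_ (fromℕ< a<ℓ₁ , fromℕ< b<ℓ₂)) <ᵇ card A
        ≡⟨ cong (_<ᵇ card A) (trans (card-below-L (fromℕ< a<ℓ₁) (fromℕ< b<ℓ₂))
             (cong₂ (λ u v → u * ℓ₂ + v) (toℕ-fromℕ< a<ℓ₁) (toℕ-fromℕ< b<ℓ₂))) ⟩
      a * ℓ₂ + b <ᵇ card A                           ≡⟨ cong (_∧ (a * ℓ₂ + b <ᵇ card A)) (<ᵇ-true b<ℓ₂) ⟨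
      columnMajor ℓ₂ (card A) a b                    ∎

-- Abel summation of weights

sumFinℚ-cong : ∀ n {f g : Fin n → ℚ} → (∀ i → f i ≡ g i) → sumFinℚ f ≡ sumFinℚ g
sumFinℚ-cong zero    _   = refl
sumFinℚ-cong (suc n) f≗g = cong₂ ℚ._+_ (f≗g Fin.zero) (sumFinℚ-cong n (f≗g ∘ Fin.suc))

sumFinℚ-+ : ∀ n (f g : Fin n → ℚ) → sumFinℚ (λ i → f i ℚ.+ g i) ≡ sumFinℚ f ℚ.+ sumFinℚ g
sumFinℚ-+ zero    f g = sym (ℚ.+-identityˡ 0ℚ)
sumFinℚ-+ (suc n) f g = trans (cong (f Fin.zero ℚ.+ g Fin.zero ℚ.+_) (sumFinℚ-+ n (f ∘ Fin.suc) (g ∘ Fin.suc)))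
                              (ℚ-interchange (f Fin.zero) (g Fin.zero) _ _)

sumFinℚ-· : ∀ n (f : Fin n → ℕ) q → sumFinℚ (λ i → f i · q) ≡ sumFinℕ f · q
sumFinℚ-· zero    f q = refl
sumFinℚ-· (suc n) f q =
  trans (cong (f Fin.zero · q ℚ.+_) (sumFinℚ-· n (f ∘ Fin.suc) q)) (sym (×-homo-+ q (f Fin.zero) _))

sumPtℚ : ∀ {ℓ₁ ℓ₂} → (Pt ℓ₁ ℓ₂ → ℚ) → ℚ
sumPtℚ F = sumFinℚ (λ a → sumFinℚ (λ b → F (a , b)))

sumPtℚ-cong : ∀ {ℓ₁ ℓ₂} {F G : Pt ℓ₁ ℓ₂ → ℚ} → (∀ x → F x ≡ G x) → sumPtℚ F ≡ sumPtℚ G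
sumPtℚ-cong {ℓ₁} {ℓ₂} F≗G = sumFinℚ-cong ℓ₁ (λ a → sumFinℚ-cong ℓ₂ (λ b → F≗G (a , b)))

sumPtℚ-+ : ∀ {ℓ₁ ℓ₂} (F G : Pt ℓ₁ ℓ₂ → ℚ) →
  sumPtℚ (λ x → F x ℚ.+ G x) ≡ sumPtℚ F ℚ.+ sumPtℚ G
sumPtℚ-+ {ℓ₁} {ℓ₂} F G =
  trans (sumFinℚ-cong ℓ₁ (λ a → sumFinℚ-+ ℓ₂ (λ b → F (a , b)) (λ b → G (a , b)))) (sumFinℚ-+ ℓ₁ _ _)

sumPtℚ-· : ∀ {ℓ₁ ℓ₂} (S : Subset ℓ₁ ℓ₂) q → sumPtℚ (λ x → [ S x ] · q) ≡ card S · q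
sumPtℚ-· {ℓ₁} {ℓ₂} S q =
  trans (sumFinℚ-cong ℓ₁ (λ a → sumFinℚ-· ℓ₂ (λ b → [ S (a , b) ]) q)) (sumFinℚ-· ℓ₁ _ q)

·-nonNeg : ∀ n {q} → 0ℚ ℚ.≤ q → 0ℚ ℚ.≤ n · q
·-nonNeg zero        _   = ℚ.≤-refl
·-nonNeg (suc n) {q} 0≤q = subst (ℚ._≤ q ℚ.+ n · q) (ℚ.+-identityˡ 0ℚ) (ℚ.+-mono-≤ 0≤q (·-nonNeg n 0≤q))

·-monoˡ-≤ : ∀ {m n} q → 0ℚ ℚ.≤ q → m ≤ n → m · q ℚ.≤ n · q
·-monoˡ-≤ {zero}  {n}     q 0≤q _         = ·-nonNeg n 0≤q
·-monoˡ-≤ {suc m} {suc n} q 0≤q (s≤s m≤n) = ℚ.+-monoʳ-≤ q (·-monoˡ-≤ q 0≤q m≤n)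

·-monoˡ-< : ∀ {m n} q → 0ℚ ℚ.< q → m < n → m · q ℚ.< n · q
·-monoˡ-< {zero}  {suc n} q 0<q _         =
  subst (ℚ._< q ℚ.+ n · q) (ℚ.+-identityˡ 0ℚ) (ℚ.+-mono-<-≤ 0<q (·-nonNeg n (ℚ.<⇒≤ 0<q)))
·-monoˡ-< {suc m} {suc n} q 0<q (s<s m<n) = ℚ.+-monoʳ-< q (·-monoˡ-< q 0<q m<n)

module _ {ℓ₁ ℓ₂ : ℕ} (wt : Weight (suc ℓ₁) (suc ℓ₂)) (increasing : RankIncreasing wt) (constant : RankConstant wt)
  where

  maxRank : ℕ
  maxRank = ℓ₁ + ℓ₂

  rank≤maxRank : ∀ (x : Pt (suc ℓ₁) (suc ℓ₂)) → rank x ≤ maxRank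
  rank≤maxRank (i , j) = +-mono-≤ (s≤s⁻¹ (toℕ<n i)) (s≤s⁻¹ (toℕ<n j))

  pointOfRank : ℕ → Pt (suc ℓ₁) (suc ℓ₂)
  pointOfRank r = fromℕ< (s≤s (m⊓n≤n r ℓ₁)) , fromℕ< (s≤s (m⊓n≤n (r ∸ ℓ₁) ℓ₂))

  rank-pointOfRank : ∀ r → r ≤ maxRank → rank (pointOfRank r) ≡ r
  rank-pointOfRank r r≤max = begin
    rank (pointOfRank r)
      ≡⟨ cong₂ _+_ (toℕ-fromℕ< (s≤s (m⊓n≤n r ℓ₁))) (toℕ-fromℕ< (s≤s (m⊓n≤n (r ∸ ℓ₁) ℓ₂))) ⟩
    r ⊓ ℓ₁ + (r ∸ ℓ₁) ⊓ ℓ₂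
      ≡⟨ cong₂ _+_ (⊓-comm r ℓ₁) (m≤n⇒m⊓n≡m (m≤n+o⇒m∸n≤o r ℓ₁ r≤max)) ⟩
    ℓ₁ ⊓ r + (r ∸ ℓ₁)
      ≡⟨ m⊓n+n∸m≡n ℓ₁ r ⟩
    r ∎
    where open ≡-Reasoning

  rankWt : ℕ → ℚ
  rankWt r = wt (pointOfRank r)

  wt≡rankWt : ∀ x → wt x ≡ rankWt (rank x)
  wt≡rankWt x = constant x (pointOfRank (rank x)) (sym (rank-pointOfRank (rank x) (rank≤maxRank x)))

  Δ : ℕ → ℚ
  Δ t = ℚ.- rankWt t ℚ.+ rankWt (suc t)

  Δ-pos : ∀ t → t < maxRank → 0ℚ ℚ.< Δ t
  Δ-pos t t<max = subst (ℚ._< Δ t) (ℚ.+-inverseˡ (rankWt t)) (ℚ.+-monoʳ-< (ℚ.- rankWt t) (increasing _ _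
    (subst₂ _<_ (sym (rank-pointOfRank t (<⇒≤ t<max))) (sym (rank-pointOfRank (suc t) t<max)) (n<1+n t))))

  cappedWt : ℕ → Subset (suc ℓ₁) (suc ℓ₂) → ℚ
  cappedWt t S = sumPtℚ (λ x → if S x then rankWt (rank x ⊓ t) else 0ℚ)

  cappedWt-zero : ∀ S → cappedWt 0 S ≡ card S · rankWt 0
  cappedWt-zero S = trans (sumPtℚ-cong capped) (sumPtℚ-· S (rankWt 0))
    where
    capped : ∀ x → (if S x then rankWt (rank x ⊓ 0) else 0ℚ) ≡ [ S x ] · rankWt 0
    capped x with S x
    ... | true  rewrite ⊓-zeroʳ (rank x) = sym (ℚ.+-identityʳ _)
    ... | false = refl

  cappedWt-suc : ∀ t S → cappedWt (suc t) S ≡ cappedWt t S ℚ.+ rankTailᶠ S (suc t) · Δ t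
  cappedWt-suc t S = begin
    cappedWt (suc t) S
      ≡⟨ sumPtℚ-cong capped ⟩
    sumPtℚ (λ x → below-t x ℚ.+ [ S x ∧ (suc t ≤ᵇ rank x) ] · Δ t)
      ≡⟨ sumPtℚ-+ below-t (λ x → [ S x ∧ (suc t ≤ᵇ rank x) ] · Δ t) ⟩
    cappedWt t S ℚ.+ sumPtℚ (λ x → [ S x ∧ (suc t ≤ᵇ rank x) ] · Δ t)
      ≡⟨ cong (cappedWt t S ℚ.+_) (sumPtℚ-· (λ x → S x ∧ (suc t ≤ᵇ rank x)) (Δ t)) ⟩
    cappedWt t S ℚ.+ rankTailᶠ S (suc t) · Δ t ∎
    where
    open ≡-Reasoning
    below-t : Pt (suc ℓ₁) (suc ℓ₂) → ℚ
    below-t x = if S x then rankWt (rank x ⊓ t) else 0ℚ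
    capped : ∀ x →
      (if S x then rankWt (rank x ⊓ suc t) else 0ℚ) ≡ below-t x ℚ.+ [ S x ∧ (suc t ≤ᵇ rank x) ] · Δ t
    capped x with S x | rank x ≤? t
    ... | false | _       = sym (ℚ.+-identityˡ 0ℚ)
    ... | true  | yes r≤t rewrite m≤n⇒m⊓n≡m r≤t | m≤n⇒m⊓n≡m (m≤n⇒m≤1+n r≤t) | ≤ᵇ-false (s≤s r≤t) =
      sym (ℚ.+-identityʳ _)
    ... | true  | no  r≰t rewrite m≥n⇒m⊓n≡n (≰⇒> r≰t) | m≥n⇒m⊓n≡n (<⇒≤ (≰⇒> r≰t)) | ≤ᵇ-true (≰⇒> r≰t) =
      sym (trans (cong (rankWt t ℚ.+_) (ℚ.+-identityʳ (Δ t))) (\\-leftDividesˡ (rankWt t) (rankWt (suc t))))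

  cappedWt-maxRank : ∀ S → cappedWt maxRank S ≡ wtSet wt S
  cappedWt-maxRank S = sumPtℚ-cong capped
    where
    capped : ∀ x → (if S x then rankWt (rank x ⊓ maxRank) else 0ℚ) ≡ (if S x then wt x else 0ℚ)
    capped x with S x
    ... | true  = trans (cong rankWt (m≤n⇒m⊓n≡m (rank≤maxRank x))) (sym (wt≡rankWt x))
    ... | false = refl

  rankTailᶠ-beyond : ∀ S s → maxRank < s → rankTailᶠ S s ≡ 0
  rankTailᶠ-beyond S s max<s = trans (rankTailᶠ-toShape {suc ℓ₁} {suc ℓ₂} S s)
    (rankTail-zero (suc ℓ₁) (suc ℓ₂) (toShape S) s
      (λ a b a≤ℓ₁ b≤ℓ₂ _ → ≤-<-trans (+-mono-≤ (s≤s⁻¹ a≤ℓ₁) (s≤s⁻¹ b≤ℓ₂)) max<s))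

  module _ (B A : Subset (suc ℓ₁) (suc ℓ₂)) (same-card : card B ≡ card A)
           (dominated : ∀ t → rankTailᶠ B t ≤ rankTailᶠ A t) where

    cappedWt-mono : ∀ t → t ≤ maxRank → cappedWt t B ℚ.≤ cappedWt t A
    cappedWt-mono zero    _     =
      ℚ.≤-reflexive (trans (cappedWt-zero B) (trans (cong (_· rankWt 0) same-card) (sym (cappedWt-zero A))))
    cappedWt-mono (suc t) t<max = subst₂ ℚ._≤_ (sym (cappedWt-suc t B)) (sym (cappedWt-suc t A))
      (ℚ.+-mono-≤ (cappedWt-mono t (<⇒≤ t<max)) (·-monoˡ-≤ (Δ t) (ℚ.<⇒≤ (Δ-pos t t<max)) (dominated (suc t))))

    cappedWt-mono-< : ∀ s → rankTailᶠ B s < rankTailᶠ A s →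
      ∀ t → s ≤ t → t ≤ maxRank → cappedWt t B ℚ.< cappedWt t A
    cappedWt-mono-< s strict zero    s≤0 _ rewrite n≤0⇒n≡0 s≤0 =
      contradiction (trans (rankTailᶠ-zero B) (trans same-card (sym (rankTailᶠ-zero A)))) (<⇒≢ strict)
    cappedWt-mono-< s strict (suc t) s≤1+t t<max =
      subst₂ ℚ._<_ (sym (cappedWt-suc t B)) (sym (cappedWt-suc t A)) (step (m≤n⇒m<n∨m≡n s≤1+t))
      where
      step : s < suc t ⊎ s ≡ suc t →
        cappedWt t B ℚ.+ rankTailᶠ B (suc t) · Δ t ℚ.< cappedWt t A ℚ.+ rankTailᶠ A (suc t) · Δ t
      step (inj₁ s≤t)  = ℚ.+-mono-<-≤ (cappedWt-mono-< s strict t (s≤s⁻¹ s≤t) (<⇒≤ t<max))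
                                      (·-monoˡ-≤ (Δ t) (ℚ.<⇒≤ (Δ-pos t t<max)) (dominated (suc t)))
      step (inj₂ refl) = ℚ.+-mono-≤-< (cappedWt-mono t (<⇒≤ t<max)) (·-monoˡ-< (Δ t) (Δ-pos t t<max) strict)

    wtSet-mono : wtSet wt B ℚ.≤ wtSet wt A
    wtSet-mono = subst₂ ℚ._≤_ (cappedWt-maxRank B) (cappedWt-maxRank A) (cappedWt-mono maxRank ≤-refl)

    wtSet-mono-< : ∀ s → rankTailᶠ B s < rankTailᶠ A s → wtSet wt B ℚ.< wtSet wt A
    wtSet-mono-< s strict with s ≤? maxRank
    ... | yes s≤max =
      subst₂ ℚ._<_ (cappedWt-maxRank B) (cappedWt-maxRank A) (cappedWt-mono-< s strict maxRank s≤max ≤-refl)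
    ... | no  s≰max = contradiction (subst (rankTailᶠ B s <_) (rankTailᶠ-beyond A s (≰⇒> s≰max)) strict) n≮0

module _ {w h : ℕ} (wt : Weight (suc w) (suc h)) (increasing : RankIncreasing wt) (constant : RankConstant wt)
         (h≤w : h ≤ w) where

  optimal-if-rowMajorTail : ∀ A → (∀ t → rankTailᶠ A t ≡ rowMajorTail (suc w) (suc h) (card A) t) → Optimal wt A
  optimal-if-rowMajorTail A tails B down same-card = wtSet-mono wt increasing constant B A same-card (λ t →
    ≤-trans (rankTailᶠ-≤-rowMajorTail (s≤s h≤w) B down t)
            (≤-reflexive (trans (cong (λ m → rowMajorTail (suc w) (suc h) m t) same-card) (sym (tails t)))))

  not-optimal-if-below-rowMajorTail : ∀ A → Downset A →
    ∀ t → rankTailᶠ A t < rowMajorTail (suc w) (suc h) (card A) t → ¬ Optimal wt A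
  not-optimal-if-below-rowMajorTail A down t A<rowMajor optimal = ℚ.<-irrefl refl (ℚ.<-≤-trans
    (wtSet-mono-< wt increasing constant A B (sym same-card) dominated t
      (subst (rankTailᶠ A t <_) (sym (tails t)) A<rowMajor))
    (optimal B (fromShape-downset (rowMajor (suc w) m) (isDownset-rowMajor (suc w) m)) same-card))
    where
    m = card A
    B : Subset (suc w) (suc h)
    B = fromShape (rowMajor (suc w) m)
    tails : ∀ t → rankTailᶠ B t ≡ rowMajorTail (suc w) (suc h) m t
    tails t = trans (rankTailᶠ-fromShape {suc w} {suc h} (rowMajor (suc w) m) t) (rowMajor-rankTail (suc w) (suc h) m t)
    same-card : card B ≡ card A
    same-card = trans (sym (rankTailᶠ-zero B)) (trans (tails 0) (rowMajorTail-size (suc w) (suc h) m (card≤area A)))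
    dominated : ∀ t → rankTailᶠ A t ≤ rankTailᶠ B t
    dominated t = subst (rankTailᶠ A t ≤_) (sym (tails t)) (rankTailᶠ-≤-rowMajorTail (s≤s h≤w) A down t)

corollary4p6 : (ℓ₁ ℓ₂ : ℕ) → 1 < ℓ₂ → ℓ₂ < ℓ₁ ∸ 1
    → (wt : Weight ℓ₁ ℓ₂) → RankIncreasing wt → RankConstant wt
    → (A : Subset ℓ₁ ℓ₂) → Downset A
    → (InitialSegment _<L_ (card A) A
    → (Optimal wt A ⇔ (card A ≤ ℓ₂ ⊎ ℓ₂ * (ℓ₁ ∸ 1) ≤ card A)))
    × (InitialSegment _<C_ (card A) A → Optimal wt A)
corollary4p6 (suc w) (suc h) 1<ℓ₂ ℓ₂<w wt increasing constant A down = segment-L , segment-C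
  where
  h≤w : h ≤ w
  h≤w = ≤-trans (n≤1+n h) (<⇒≤ ℓ₂<w)
  segment-C : InitialSegment _<C_ (card A) A → Optimal wt A
  segment-C segment = optimal-if-rowMajorTail wt increasing constant h≤w A (rankTailᶠ-initialSegment-C A segment)
  segment-L : InitialSegment _<L_ (card A) A → Optimal wt A ⇔ (card A ≤ suc h ⊎ suc h * w ≤ card A)
  segment-L segment = mk⇔ small-or-large (λ size-condition →
    optimal-if-rowMajorTail wt increasing constant h≤w A (λ t → trans (rankTailᶠ-initialSegment-L A segment t)
      (rowMajorTail-transpose w h (card A) h≤w (card≤area A) size-condition t)))
    where
    small-or-large : Optimal wt A → card A ≤ suc h ⊎ suc h * w ≤ card A
    small-or-large optimal with card A ≤? suc h | suc h * w ≤? card A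
    ... | yes small  | _         = inj₁ small
    ... | no  _      | yes large = inj₂ large
    ... | no  ¬small | no ¬large
      with t , L<C ← rowMajorTail-transpose-< w h (card A) (s≤s⁻¹ 1<ℓ₂) ℓ₂<w (≰⇒> ¬small) (≰⇒> ¬large) =
      contradiction optimal (not-optimal-if-below-rowMajorTail wt increasing constant h≤w A down t
        (subst (_< rowMajorTail (suc w) (suc h) (card A) t) (sym (rankTailᶠ-initialSegment-L A segment t)) L<C))
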